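{- Let $v\ge 1$ and $f\in\{0,\ldots,v-1\}$ with $v-f$ even, and let $A_{v,f}$ be the block-diagonal matrix over $\mathbb{F}_2$ consisting of $\frac{v-f}{2}$ consecutive $2\times 2$ blocks $\begin{pmatrix}0&1\\1&1\end{pmatrix}$ followed by an $f\times f$ identity matrix. Under the action of $\langle A_{v,f}\rangle$ on the $3$-dimensional subspaces (planes) of $\mathbb{F}_2^v$, the number of fixed planes of type $7$ equals $\binom{f}{3}_2=\frac{(2^f-1)(2^{f-1}-1)(2^{f-2}-1)}{21}$, and the number of fixed planes of type $1$ equals the number of orbit triangles, namely $\frac{(2^f-1)(2^{v-f}-1)}{3}$.
   Context: $\langle A_{v,f}\rangle$ acts on subspaces of $\mathbb{F}_2^v$ via $\mathbf{x}\mapsto \mathbf{x}A_{v,f}$. $\binom{f}{3}_2$ is the Gaussian binomial coefficient (number of $3$-dimensional subspaces of $\mathbb{F}_2^f$). A fixed plane $E$ is of type $7$ if all $7$ of its points ($1$-subspaces) are fixed, i.e. the restriction of the action to $E$ is trivial; otherwise the restriction has order $3$ and $E$ is said to be of type $1$ (it then contains exactly one fixed point, one orbit line and one orbit triangle). Among point orbits of size $3$, an orbit line is one whose three points are collinear, an orbit triangle one whose points are not collinear. -}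

module Defs where

open import Data.Bool using (Bool; true; false; _∧_; _xor_; not; if_then_else_)
open import Data.Nat using (ℕ; zero; suc; _∸_; _<ᵇ_; _≡ᵇ_; _/_; _%_)
open import Data.Fin using (Fin; toℕ)
open import Data.Vec using (Vec; []; _∷_; lookup; tabulate; zipWith; replicate)
open import Data.List using (List; []; _∷_; _++_; map; foldr; allFin)
open import Data.List.Membership.Propositional using (_∈_)
open import Data.List.Relation.Unary.Unique.Propositional using (Unique)
open import Data.Product using (Σ; ∃; ∃-syntax; _×_)
open import Relation.Binary.PropositionalEquality using (_≡_; _≢_)
open import Relation.Nullary using (¬_)
open import Function.Bundles using (_⇔_)

-- Vectors of F₂^v (row vectors), entries in Bool = F₂.
V : ℕ → Set
V v = Vec Bool v

_⊕_ : ∀ {v} → V v → V v → V v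
_⊕_ = zipWith _xor_

0v : ∀ {v} → V v
0v {v} = replicate v false

-- v × v matrices over F₂, indexed (row, column)
Mat : ℕ → Set
Mat v = Fin v → Fin v → Bool

_·ᴹ_ : ∀ {v} → V v → Mat v → V v
_·ᴹ_ {v} x M = tabulate (λ j → foldr _xor_ false (map (λ i → lookup x i ∧ M i j) (allFin v)))

-- Entry (i,j): if both i,j < v ∸ f: nonzero iff i,j lie in the same 2×2 block
-- (i/2 = j/2) and not both even (the (0,0) entry of the block is 0);
-- if both i,j ≥ v ∸ f: identity; otherwise 0.
A : (v f : ℕ) → Mat v
A v f i j with toℕ i <ᵇ (v ∸ f) | toℕ j <ᵇ (v ∸ f)
... | true  | true  = ((toℕ i / 2) ≡ᵇ (toℕ j / 2)) ∧ not (((toℕ i % 2) ≡ᵇ 0) ∧ ((toℕ j % 2) ≡ᵇ 0))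
... | false | false = toℕ i ≡ᵇ toℕ j
... | _     | _     = false

-- action of the group element A_{v,f}^n on vectors: x ↦ x A^n
-- (⟨A⟩ is finite, so ⟨A⟩ = { A^n | n ∈ ℕ })
act^ : (v f : ℕ) → ℕ → V v → V v
act^ v f zero    x = x
act^ v f (suc n) x = act^ v f n x ·ᴹ A v f

allVecs : (v : ℕ) → List (V v)
allVecs zero    = [] ∷ []
allVecs (suc v) = map (false ∷_) (allVecs v) ++ map (true ∷_) (allVecs v)

-- all sublists of a list; for a duplicate-free list these are canonical
-- representatives of its subsets (one per subset)
sublists : ∀ {a} {X : Set a} → List X → List (List X)
sublists []       = [] ∷ []
sublists (x ∷ xs) = map (x ∷_) (sublists xs) ++ sublists xs

Subsets : (v : ℕ) → List (List (V v))
Subsets v = sublists (allVecs v)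

combo : ∀ {v d} → Vec Bool d → Vec (V v) d → V v
combo []       []       = 0v
combo (c ∷ cs) (b ∷ bs) = if c then b ⊕ combo cs bs else combo cs bs

LinIndep : ∀ {v d} → Vec (V v) d → Set
LinIndep {v} {d} B = ∀ (c : Vec Bool d) → combo c B ≡ 0v → c ≡ replicate d false

IsSubspaceOfDim : (v d : ℕ) → List (V v) → Set
IsSubspaceOfDim v d S =
  Σ (Vec (V v) d) λ B → LinIndep B × (∀ y → (y ∈ S) ⇔ (∃[ c ] combo c B ≡ y))

IsPlane : (v : ℕ) → List (V v) → Set
IsPlane v = IsSubspaceOfDim v 3

IsLine : (v : ℕ) → List (V v) → Set
IsLine v = IsSubspaceOfDim v 2

FixedPlane : (v f : ℕ) → List (V v) → Set
FixedPlane v f E =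
  IsPlane v E × (∀ n y → (y ∈ E) ⇔ (∃[ x ] (x ∈ E × act^ v f n x ≡ y)))

Type7 : (v f : ℕ) → List (V v) → Set
Type7 v f E = FixedPlane v f E ×
  (∀ x → x ∈ E → x ≢ 0v → ∀ n → act^ v f n x ≡ x)

Type1 : (v f : ℕ) → List (V v) → Set
Type1 v f E = FixedPlane v f E × ¬ (∀ x → x ∈ E → x ≢ 0v → ∀ n → act^ v f n x ≡ x)

-- O is (the set of nonzero representatives of) a point orbit:
-- the orbit of the point ⟨x⟩ (x ≠ 0) under ⟨A⟩
IsPointOrbit : (v f : ℕ) → List (V v) → Set
IsPointOrbit v f O = ∃[ x ] (x ≢ 0v × (∀ y → (y ∈ O) ⇔ (∃[ n ] act^ v f n x ≡ y)))

Collinear : (v : ℕ) → List (V v) → Set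
Collinear v O = ∃[ L ] (IsLine v L × (∀ y → y ∈ O → y ∈ L))

OrbitTriangle : (v f : ℕ) → List (V v) → Set
OrbitTriangle v f O = IsPointOrbit v f O × Data.List.length O ≡ 3 × ¬ Collinear v O
  where import Data.List

NumberOf : (v : ℕ) → (List (V v) → Set) → ℕ → Set
NumberOf v P n =
  Σ (List (List (V v))) λ L →
    Unique L × (∀ S → (S ∈ L) ⇔ (S ∈ Subsets v × P S)) × Data.List.length L ≡ n
  where import Data.List

module Submission where

open import Defs
open import Data.Nat using (ℕ; _≤_; _<_; _∸_; _*_; _^_)
open import Data.Nat.Divisibility using (_∣_)
open import Data.Product using (∃-syntax; _×_)
open import Relation.Binary.PropositionalEquality using (_≡_)

open import Level using (0ℓ)
open import Data.Nat.Divisibility using (divides)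
open import Algebra.Bundles using (CommutativeMonoid; CommutativeRing)
open import Algebra.Structures using (IsCommutativeMonoid)
import Algebra.Properties.CommutativeSemigroup as CommSemigroupProps
open import Data.Nat as N using (zero; suc; _+_; z≤n; s≤s; _≡ᵇ_; _<ᵇ_)
import Data.Nat.Properties as NP
import Data.Nat.DivMod as DM
open import Data.Nat.Tactic.RingSolver using (solve-∀)
open import Data.Bool as B using (Bool; true; false; _∧_; _xor_; not; if_then_else_; T)
import Data.Bool.Properties as BP
open import Data.Vec as V using (Vec; []; _∷_; lookup; zipWith; replicate; _++_; take; drop)
import Data.Vec.Properties as VecP
open import Data.List as L using (List; []; _∷_; map; foldr; allFin; length; filter)
import Data.List.Properties as LP
open import Data.List.Membership.Propositional using (_∈_)
open import Data.List.Membership.Propositional.Properties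
  using (∈-map⁺; ∈-map⁻; ∈-++⁺ˡ; ∈-++⁺ʳ; ∈-++⁻; ∈-filter⁺; ∈-filter⁻)
open import Data.List.Relation.Unary.Any as Any using (here; there)
open import Data.List.Relation.Unary.All as All using ([]; _∷_)
open import Data.List.Relation.Unary.Unique.Propositional using (Unique; []; _∷_)
open import Data.List.Relation.Unary.Unique.Propositional.Properties using (map⁺; ++⁺)
open import Data.List.Relation.Binary.Disjoint.Propositional using (Disjoint)
open import Data.Product using (_,_; proj₁; proj₂)
open import Data.Sum using (_⊎_; inj₁; inj₂)
open import Data.Empty using (⊥; ⊥-elim)
open import Data.Unit using (tt)
open import Relation.Nullary using (¬_; Dec; yes; no; does)
open import Relation.Unary using (Decidable)
open import Relation.Nullary.Decidable using (_⊎-dec_; _×-dec_)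
open import Relation.Binary.PropositionalEquality as PE
  using (_≢_; refl; sym; trans; cong; cong₂; subst; module ≡-Reasoning)
open import Function using (case_of_)
open import Function.Bundles using (_⇔_; mk⇔; Equivalence)
open import Data.List.Membership.Propositional.Properties.WithK using (unique∧set⇒bag)
open import Data.List.Relation.Binary.BagAndSetEquality using (∼bag⇒↭)
open import Data.List.Relation.Binary.Permutation.Propositional.Properties using (↭-length)
open import Data.Fin as F using (Fin; toℕ)

-- Write x ∈ F₂^v as x = u ++ w with u ∈ F₂^(2q), w ∈ F₂^f.  Then
-- x A_{v,f} = ρ u ++ w, where ρ = rot q applies (a , b) ↦ (b , a + b) to each
-- coordinate pair; ρ is linear, ρ³ = 1 and ρ fixes no nonzero vector, so the
-- nonzero vectors of F₂^(2q) fall into (2^(2q) ∸ 1)/3 orbits of size 3.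
--  * A type-7 plane consists of fixed vectors, i.e. it is 0 ++ E for a plane E
--    of F₂^f.  Planes of F₂^f correspond to reduced echelon bases, whose
--    number g(3,f) satisfies g(3,f)·21 = (2^f-1)(2^(f-1)-1)(2^(f-2)-1).
--  * A type-1 plane is E(u,p) = (orbit line of u) ++ 0 + ⟨0 ++ p⟩ for a unique
--    orbit of u ≠ 0 and a unique p ≠ 0; the orbit of u ++ p is the orbit
--    triangle with the same data.  Both kinds are therefore counted by the pairs
--    (orbit representative, p ≠ 0), of which there are (2^(2q)-1)/3 · (2^f-1).

⊕-assoc : ∀ {n} (x y z : V n) → (x ⊕ y) ⊕ z ≡ x ⊕ (y ⊕ z)
⊕-assoc []      []      []      = refl
⊕-assoc (a ∷ x) (b ∷ y) (c ∷ z) = cong₂ _∷_ (BP.xor-assoc a b c) (⊕-assoc x y z)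

⊕-comm : ∀ {n} (x y : V n) → x ⊕ y ≡ y ⊕ x
⊕-comm []      []      = refl
⊕-comm (a ∷ x) (b ∷ y) = cong₂ _∷_ (BP.xor-comm a b) (⊕-comm x y)

⊕-identityˡ : ∀ {n} (x : V n) → 0v ⊕ x ≡ x
⊕-identityˡ []      = refl
⊕-identityˡ (a ∷ x) = cong (a ∷_) (⊕-identityˡ x)

⊕-identityʳ : ∀ {n} (x : V n) → x ⊕ 0v ≡ x
⊕-identityʳ x = trans (⊕-comm x 0v) (⊕-identityˡ x)

⊕-self : ∀ {n} (x : V n) → x ⊕ x ≡ 0v
⊕-self []      = refl
⊕-self (a ∷ x) = cong₂ _∷_ (BP.xor-same a) (⊕-self x)

⊕-isCommutativeMonoid : ∀ n → IsCommutativeMonoid _≡_ (_⊕_ {n}) 0v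
⊕-isCommutativeMonoid n = record
  { isMonoid = record
    { isSemigroup = record
      { isMagma = record { isEquivalence = PE.isEquivalence ; ∙-cong = cong₂ _⊕_ }
      ; assoc   = ⊕-assoc }
    ; identity = ⊕-identityˡ , ⊕-identityʳ }
  ; comm = ⊕-comm }

⊕-commutativeMonoid : ℕ → CommutativeMonoid 0ℓ 0ℓ
⊕-commutativeMonoid n = record { isCommutativeMonoid = ⊕-isCommutativeMonoid n }

⊕-interchange : ∀ {n} (a b c d : V n) → (a ⊕ b) ⊕ (c ⊕ d) ≡ (a ⊕ c) ⊕ (b ⊕ d)
⊕-interchange {n} = CS.interchange
  where module CS = CommSemigroupProps (CommutativeMonoid.commutativeSemigroup (⊕-commutativeMonoid n))

xor-interchange : ∀ a b c d → (a xor b) xor (c xor d) ≡ (a xor c) xor (b xor d)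
xor-interchange = CS.interchange
  where module CS = CommSemigroupProps (CommutativeRing.+-commutativeSemigroup BP.xor-∧-commutativeRing)

⊕-cancelʳ : ∀ {n} (x y : V n) → (x ⊕ y) ⊕ y ≡ x
⊕-cancelʳ x y = trans (⊕-assoc x y y) (trans (cong (x ⊕_) (⊕-self y)) (⊕-identityʳ x))

⊕≡0⇒≡ : ∀ {n} (x y : V n) → x ⊕ y ≡ 0v → x ≡ y
⊕≡0⇒≡ x y e = trans (sym (⊕-cancelʳ x y)) (trans (cong (_⊕ y) e) (⊕-identityˡ y))

_≟ᵛ_ : ∀ {n} (x y : V n) → Dec (x ≡ y)
_≟ᵛ_ = VecP.≡-dec B._≟_

_·_ : ∀ {n} → Bool → V n → V n
c · x = if c then x else 0v

·-⊕ : ∀ {n} (c : Bool) (x y : V n) → c · (x ⊕ y) ≡ (c · x) ⊕ (c · y)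
·-⊕ true  x y = refl
·-⊕ false x y = sym (⊕-self 0v)

xor-· : ∀ {n} (a a' : Bool) (b : V n) → (a xor a') · b ≡ (a · b) ⊕ (a' · b)
xor-· false a'    b = sym (⊕-identityˡ _)
xor-· true  false b = sym (⊕-identityʳ b)
xor-· true  true  b = sym (⊕-self b)

·-0v : ∀ {n} (c : Bool) → c · 0v {n} ≡ 0v
·-0v true  = refl
·-0v false = refl

⊕-++ : ∀ {m n} (a b : V m) (c d : V n) → (a ++ c) ⊕ (b ++ d) ≡ (a ⊕ b) ++ (c ⊕ d)
⊕-++ []      []      c d = refl
⊕-++ (x ∷ a) (y ∷ b) c d = cong ((x xor y) ∷_) (⊕-++ a b c d)

0v-++ : ∀ {m n} → 0v {m} ++ 0v {n} ≡ 0v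
0v-++ {zero}  = refl
0v-++ {suc m} = cong (false ∷_) (0v-++ {m})

take-++ : ∀ {m n} (a : V m) (c : V n) → take m (a ++ c) ≡ a
take-++ []      c = refl
take-++ (b ∷ a) c = cong (b ∷_) (take-++ a c)

drop-++ : ∀ {m n} (a : V m) (c : V n) → drop m (a ++ c) ≡ c
drop-++ []      c = refl
drop-++ (b ∷ a) c = drop-++ a c

++≡0⇒ˡ : ∀ {m n} {a : V m} {c : V n} → a ++ c ≡ 0v → a ≡ 0v
++≡0⇒ˡ {m} {n} {a} e = proj₁ (VecP.++-injective a 0v (trans e (sym (0v-++ {m} {n}))))

++≡0⇒ʳ : ∀ {m n} {a : V m} {c : V n} → a ++ c ≡ 0v → c ≡ 0v
++≡0⇒ʳ {m} {n} {a} e = proj₂ (VecP.++-injective a 0v (trans e (sym (0v-++ {m} {n}))))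

combo-∷ : ∀ {v d} (c : Bool) (cs : Vec Bool d) (b : V v) (B : Vec (V v) d) →
  combo (c ∷ cs) (b ∷ B) ≡ (c · b) ⊕ combo cs B
combo-∷ true  cs b B = refl
combo-∷ false cs b B = sym (⊕-identityˡ _)

combo-zeroˡ : ∀ {v d} (B : Vec (V v) d) → combo (replicate d false) B ≡ 0v
combo-zeroˡ []      = refl
combo-zeroˡ (b ∷ B) = combo-zeroˡ B

combo-zeroʳ : ∀ {v d} (c : Vec Bool d) → combo c (replicate d (0v {v})) ≡ 0v
combo-zeroʳ []          = refl
combo-zeroʳ (false ∷ c) = combo-zeroʳ c
combo-zeroʳ (true ∷ c)  = trans (⊕-identityˡ _) (combo-zeroʳ c)

combo-⊕ : ∀ {v d} (c c' : Vec Bool d) (B : Vec (V v) d) →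
  combo (c ⊕ c') B ≡ combo c B ⊕ combo c' B
combo-⊕ []          []           []      = sym (⊕-self 0v)
combo-⊕ (x ∷ c) (y ∷ c') (b ∷ B) = begin
    combo ((x xor y) ∷ (c ⊕ c')) (b ∷ B)           ≡⟨ combo-∷ (x xor y) (c ⊕ c') b B ⟩
    ((x xor y) · b) ⊕ combo (c ⊕ c') B             ≡⟨ cong₂ _⊕_ (xor-· x y b) (combo-⊕ c c' B) ⟩
    ((x · b) ⊕ (y · b)) ⊕ (combo c B ⊕ combo c' B) ≡⟨ ⊕-interchange _ _ _ _ ⟩
    ((x · b) ⊕ combo c B) ⊕ ((y · b) ⊕ combo c' B) ≡⟨ cong₂ _⊕_ (sym (combo-∷ x c b B)) (sym (combo-∷ y c' b B)) ⟩
    combo (x ∷ c) (b ∷ B) ⊕ combo (y ∷ c') (b ∷ B) ∎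
  where open ≡-Reasoning

combo-· : ∀ {v d} (c0 : Bool) (cs : Vec Bool d) (B : Vec (V v) d) → combo (c0 · cs) B ≡ c0 · combo cs B
combo-· true  cs B = refl
combo-· false cs B = combo-zeroˡ B

combo-combo : ∀ {v d m} (e : Vec Bool m) (Cs : Vec (Vec Bool d) m) (B : Vec (V v) d) →
  combo e (V.map (λ c → combo c B) Cs) ≡ combo (combo e Cs) B
combo-combo []          []       B = sym (combo-zeroˡ B)
combo-combo (false ∷ e) (c ∷ Cs) B = combo-combo e Cs B
combo-combo (true ∷ e)  (c ∷ Cs) B =
  trans (cong (combo c B ⊕_) (combo-combo e Cs B)) (sym (combo-⊕ c (combo e Cs) B))

combo-map : ∀ {m n d} (φ : V m → V n) → (∀ x y → φ (x ⊕ y) ≡ φ x ⊕ φ y) → φ 0v ≡ 0v →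
  (c : Vec Bool d) (B : Vec (V m) d) → φ (combo c B) ≡ combo c (V.map φ B)
combo-map φ φ⊕ φ0 []          []      = φ0
combo-map φ φ⊕ φ0 (false ∷ c) (b ∷ B) = combo-map φ φ⊕ φ0 c B
combo-map φ φ⊕ φ0 (true ∷ c)  (b ∷ B) = trans (φ⊕ b _) (cong (φ b ⊕_) (combo-map φ φ⊕ φ0 c B))

combo-++ : ∀ {m n d} (c : Vec Bool d) (Us : Vec (V m) d) (Ws : Vec (V n) d) →
  combo c (zipWith _++_ Us Ws) ≡ combo c Us ++ combo c Ws
combo-++ {m} {n} []      []       []       = sym (0v-++ {m} {n})
combo-++ (false ∷ c) (u ∷ Us) (w ∷ Ws) = combo-++ c Us Ws
combo-++ (true ∷ c)  (u ∷ Us) (w ∷ Ws) =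
  trans (cong ((u ++ w) ⊕_) (combo-++ c Us Ws)) (⊕-++ u _ w _)

combo-0∷ : ∀ {f d} (c : Vec Bool d) (R : Vec (V f) d) → combo c (V.map (false ∷_) R) ≡ false ∷ combo c R
combo-0∷ c R = sym (combo-map (false ∷_) (λ _ _ → refl) refl c R)

InSpan : ∀ {v d} → Vec (V v) d → V v → Set
InSpan B y = ∃[ c ] combo c B ≡ y

_⊑_ : ∀ {v d e} → Vec (V v) d → Vec (V v) e → Set
X ⊑ Y = ∀ y → InSpan X y → InSpan Y y

span-0 : ∀ {v d} (B : Vec (V v) d) → InSpan B 0v
span-0 {d = d} B = replicate d false , combo-zeroˡ B

span-⊕ : ∀ {v d} (B : Vec (V v) d) {x y} → InSpan B x → InSpan B y → InSpan B (x ⊕ y)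
span-⊕ B (c , refl) (c' , refl) = c ⊕ c' , combo-⊕ c c' B

span-· : ∀ {v d} (B : Vec (V v) d) (c : Bool) {x} → InSpan B x → InSpan B (c · x)
span-· B true  s = s
span-· B false s = span-0 B

span-gen : ∀ {v d} (B : Vec (V v) d) (i : Fin d) → InSpan B (lookup B i)
span-gen (b ∷ B) F.zero    = (true ∷ replicate _ false) , trans (cong (b ⊕_) (combo-zeroˡ B)) (⊕-identityʳ b)
span-gen (b ∷ B) (F.suc i) = let (c , e) = span-gen B i in false ∷ c , e

span-⊑ : ∀ {v d e} (X : Vec (V v) d) (Y : Vec (V v) e) → (∀ i → InSpan Y (lookup X i)) → X ⊑ Y
span-⊑ []      Y h _ ([] , refl)          = span-0 Y
span-⊑ (x ∷ X) Y h _ (false ∷ c , refl)  = span-⊑ X Y (λ i → h (F.suc i)) _ (c , refl)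
span-⊑ (x ∷ X) Y h _ (true ∷ c , refl)   = span-⊕ Y (h F.zero) (span-⊑ X Y (λ i → h (F.suc i)) _ (c , refl))

-- A subset is represented by its canonical
-- sublist of allVecs v; to count the subsets with a property P it suffices
-- to give a duplicate-free list of parameters p, each describing (by a
-- decidable predicate Q p) exactly one subset with property P, every such
-- subset being described by some p.

allVecs-∈ : ∀ {v} (x : V v) → x ∈ allVecs v
allVecs-∈ []                  = here refl
allVecs-∈ {suc v} (false ∷ x) = ∈-++⁺ˡ (∈-map⁺ (false ∷_) (allVecs-∈ x))
allVecs-∈ {suc v} (true ∷ x)  = ∈-++⁺ʳ (map (false ∷_) (allVecs v)) (∈-map⁺ (true ∷_) (allVecs-∈ x))

∷-injʳ : ∀ {n} {b : Bool} {x y : V n} → b ∷ x ≡ b ∷ y → x ≡ y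
∷-injʳ = VecP.∷-injectiveʳ

disjoint-images : ∀ {P P' C : Set} {xs : List P} {ys : List P'} (g : P → C) (h : P' → C) →
  (∀ {p p'} → g p ≢ h p') → Disjoint (map g xs) (map h ys)
disjoint-images g h g≢h (a , b) with ∈-map⁻ g a | ∈-map⁻ h b
... | p , _ , refl | p' , _ , e = g≢h e

allVecs-unique : ∀ v → Unique (allVecs v)
allVecs-unique zero    = [] ∷ []
allVecs-unique (suc v) = ++⁺ (map⁺ ∷-injʳ (allVecs-unique v)) (map⁺ ∷-injʳ (allVecs-unique v))
  (disjoint-images (false ∷_) (true ∷_) λ ())

length-allVecs : ∀ v → length (allVecs v) ≡ 2 ^ v
length-allVecs zero    = refl
length-allVecs (suc v) = begin
    length (map (false ∷_) (allVecs v) L.++ map (true ∷_) (allVecs v))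
      ≡⟨ LP.length-++ (map (false ∷_) (allVecs v)) ⟩
    length (map (false ∷_) (allVecs v)) + length (map (true ∷_) (allVecs v))
      ≡⟨ cong₂ _+_ (LP.length-map _ (allVecs v)) (LP.length-map _ (allVecs v)) ⟩
    length (allVecs v) + length (allVecs v)
      ≡⟨ cong₂ _+_ (length-allVecs v) (length-allVecs v) ⟩
    2 ^ v + 2 ^ v
      ≡⟨ cong (2 ^ v +_) (sym (NP.+-identityʳ (2 ^ v))) ⟩
    2 ^ suc v ∎
  where open ≡-Reasoning

unique-map-on : ∀ {A C : Set} {f : A → C} {xs : List A} →
  (∀ {x y} → x ∈ xs → y ∈ xs → f x ≡ f y → x ≡ y) → Unique xs → Unique (map f xs)
unique-map-on {xs = []}     inj []       = []
unique-map-on {f = f} {xs = x ∷ xs} inj (px ∷ u) =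
  All.tabulate (λ z∈ e → let (y , y∈ , ez) = ∈-map⁻ f z∈ in
    All.lookup px y∈ (inj (here refl) (there y∈) (trans e ez)))
  ∷ unique-map-on (λ a b → inj (there a) (there b)) u

filter-sublist : ∀ {A : Set} {Q : A → Set} (Q? : Decidable Q) (xs : List A) → filter Q? xs ∈ sublists xs
filter-sublist Q? []       = here refl
filter-sublist Q? (x ∷ xs) with does (Q? x)
... | true  = ∈-++⁺ˡ (∈-map⁺ (x ∷_) (filter-sublist Q? xs))
... | false = ∈-++⁺ʳ (map (x ∷_) (sublists xs)) (filter-sublist Q? xs)

sublist-∈ : ∀ {A : Set} {xs S : List A} → S ∈ sublists xs → ∀ {y} → y ∈ S → y ∈ xs
sublist-∈ {xs = []}     (here refl) ()
sublist-∈ {xs = x ∷ xs} h yS with ∈-++⁻ (map (x ∷_) (sublists xs)) h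
... | inj₂ h' = there (sublist-∈ h' yS)
... | inj₁ h' with ∈-map⁻ (x ∷_) h'
... | S' , h'' , refl with yS
... | here refl = here refl
... | there yS' = there (sublist-∈ h'' yS')

sublist-unique : ∀ {A : Set} {xs S : List A} → Unique xs → S ∈ sublists xs → Unique S
sublist-unique {xs = []}     []       (here refl) = []
sublist-unique {xs = x ∷ xs} (px ∷ u) h with ∈-++⁻ (map (x ∷_) (sublists xs)) h
... | inj₂ h' = sublist-unique u h'
... | inj₁ h' with ∈-map⁻ (x ∷_) h'
... | S' , S∈ , refl = All.tabulate (λ y∈ e → All.lookup px (sublist-∈ S∈ y∈) e) ∷ sublist-unique u S∈

sublist-ext : ∀ {A : Set} {xs S T : List A} → Unique xs → S ∈ sublists xs → T ∈ sublists xs →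
  (∀ y → y ∈ S → y ∈ T) → (∀ y → y ∈ T → y ∈ S) → S ≡ T
sublist-ext {xs = []} u (here refl) (here refl) a b = refl
sublist-ext {xs = x ∷ xs} (px ∷ u) hS hT a b
  with ∈-++⁻ (map (x ∷_) (sublists xs)) hS | ∈-++⁻ (map (x ∷_) (sublists xs)) hT
... | inj₁ s | inj₁ t with ∈-map⁻ (x ∷_) s | ∈-map⁻ (x ∷_) t
... | S' , s' , refl | T' , t' , refl =
  cong (x ∷_) (sublist-ext u s' t' (λ y y∈ → drop-x s' y∈ (a y (there y∈))) (λ y y∈ → drop-x t' y∈ (b y (there y∈))))
  where
  drop-x : ∀ {U W} → U ∈ sublists xs → ∀ {y} → y ∈ U → y ∈ x ∷ W → y ∈ W
  drop-x U∈ y∈ (here refl) = ⊥-elim (All.lookup px (sublist-∈ U∈ y∈) refl)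
  drop-x U∈ y∈ (there h)   = h
sublist-ext {xs = x ∷ xs} (px ∷ u) hS hT a b | inj₁ s | inj₂ t with ∈-map⁻ (x ∷_) s
... | S' , s' , refl = ⊥-elim (All.lookup px (sublist-∈ t (a x (here refl))) refl)
sublist-ext {xs = x ∷ xs} (px ∷ u) hS hT a b | inj₂ s | inj₁ t with ∈-map⁻ (x ∷_) t
... | T' , t' , refl = ⊥-elim (All.lookup px (sublist-∈ s (b x (here refl))) refl)
sublist-ext {xs = x ∷ xs} (px ∷ u) hS hT a b | inj₂ s | inj₂ t = sublist-ext u s t a b

InSpan? : ∀ {v d} (B : Vec (V v) d) (y : V v) → Dec (InSpan B y)
InSpan? {d = d} B y with Any.any? (λ c → combo c B ≟ᵛ y) (allVecs d)
... | yes a = yes (Any.satisfied a)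
... | no na = no (λ (c , e) → na (Any.map (λ { refl → e }) (allVecs-∈ c)))

_enumerates_ : ∀ {v} → List (V v) → (V v → Set) → Set
S enumerates Q = (∀ y → y ∈ S → Q y) × (∀ y → Q y → y ∈ S)

subsetOf : ∀ {v} {Q : V v → Set} → Decidable Q → List (V v)
subsetOf {v} Q? = filter Q? (allVecs v)

subsetOf-enumerates : ∀ {v} {Q : V v → Set} (Q? : Decidable Q) → subsetOf Q? enumerates Q
subsetOf-enumerates {v} Q? = (λ y y∈ → proj₂ (∈-filter⁻ Q? {xs = allVecs v} y∈)) , (λ y q → ∈-filter⁺ Q? (allVecs-∈ y) q)

subsetOf-canonical : ∀ {v} {Q : V v → Set} (Q? : Decidable Q) → subsetOf Q? ∈ Subsets v
subsetOf-canonical {v} Q? = filter-sublist Q? (allVecs v)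

count-by-parameters : ∀ {v} {Par : Set} (ps : List Par) (Q : Par → V v → Set) (Q? : ∀ p → Decidable (Q p))
  (P : List (V v) → Set) → Unique ps →
  (∀ {p p'} → p ∈ ps → p' ∈ ps → (∀ y → Q p y → Q p' y) → (∀ y → Q p' y → Q p y) → p ≡ p') →
  (∀ {p} → p ∈ ps → ∀ S → Unique S → S enumerates Q p → P S) →
  (∀ S → S ∈ Subsets v → P S → ∃[ p ] (p ∈ ps × S enumerates Q p)) →
  NumberOf v P (length ps)
count-by-parameters {v} {Par} ps Q Q? P uniq inj valid complete =
  map rep ps , unique-map-on rep-inj uniq , (λ S → mk⇔ (to S) (from S)) , LP.length-map rep ps
  where
  rep : Par → List (V v)
  rep p = subsetOf (Q? p)
  rep-inj : ∀ {p p'} → p ∈ ps → p' ∈ ps → rep p ≡ rep p' → p ≡ p'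
  rep-inj {p} {p'} a b e = inj a b
    (λ y q → proj₁ (subsetOf-enumerates (Q? p')) y (subst (y ∈_) e (proj₂ (subsetOf-enumerates (Q? p)) y q)))
    (λ y q → proj₁ (subsetOf-enumerates (Q? p)) y (subst (y ∈_) (sym e) (proj₂ (subsetOf-enumerates (Q? p')) y q)))
  to : ∀ S → S ∈ map rep ps → S ∈ Subsets v × P S
  to S h with ∈-map⁻ rep h
  ... | p , p∈ , refl = subsetOf-canonical (Q? p) ,
        valid p∈ _ (sublist-unique (allVecs-unique v) (subsetOf-canonical (Q? p))) (subsetOf-enumerates (Q? p))
  from : ∀ S → S ∈ Subsets v × P S → S ∈ map rep ps
  from S (s , pS) with complete S s pS
  ... | p , p∈ , a , b = subst (_∈ map rep ps)
        (sublist-ext (allVecs-unique v) (subsetOf-canonical (Q? p)) s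
           (λ y y∈ → b y (proj₁ (subsetOf-enumerates (Q? p)) y y∈))
           (λ y y∈ → proj₂ (subsetOf-enumerates (Q? p)) y (a y y∈)))
        (∈-map⁺ rep p∈)

-- For v = 2q + f and x = u ++ w we show
-- x A_{v,f} = rot q u ++ w, where rot applies (a , b) ↦ (b , a + b) to each
-- consecutive pair of coordinates (row vector times the block [[0,1],[1,1]]).
-- The matrix product is computed column by column, after translating
-- Fin-indexed lookups and sums into ℕ-indexed ones.

rot : ∀ q → V (q * 2) → V (q * 2)
rot zero    []          = []
rot (suc q) (a ∷ b ∷ u) = b ∷ (a xor b) ∷ rot q u

-- the t-th coordinate of x (false beyond the length)
at : ∀ {n} → Vec Bool n → ℕ → Bool
at []      _       = false
at (a ∷ x) zero    = a
at (a ∷ x) (suc t) = at x t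

lookup-at : ∀ {n} (x : Vec Bool n) (i : Fin n) → lookup x i ≡ at x (toℕ i)
lookup-at (a ∷ x) F.zero    = refl
lookup-at (a ∷ x) (F.suc i) = lookup-at x i

xorSum : ℕ → (ℕ → Bool) → Bool
xorSum zero    h = false
xorSum (suc n) h = h 0 xor xorSum n (λ i → h (suc i))

xorSum-cong : ∀ n {h h' : ℕ → Bool} → (∀ i → h i ≡ h' i) → xorSum n h ≡ xorSum n h'
xorSum-cong zero    e = refl
xorSum-cong (suc n) e = cong₂ _xor_ (e 0) (xorSum-cong n (λ i → e (suc i)))

xorSum-xor : ∀ n (h h' : ℕ → Bool) → xorSum n (λ i → h i xor h' i) ≡ xorSum n h xor xorSum n h'
xorSum-xor zero    h h' = refl
xorSum-xor (suc n) h h' =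
  trans (cong ((h 0 xor h' 0) xor_) (xorSum-xor n _ _)) (xor-interchange (h 0) (h' 0) _ _)

xorSum-false : ∀ n → xorSum n (λ _ → false) ≡ false
xorSum-false zero    = refl
xorSum-false (suc n) = xorSum-false n

xorSum-delta : ∀ {n} (x : Vec Bool n) (s : ℕ) → xorSum n (λ i → at x i ∧ (i ≡ᵇ s)) ≡ at x s
xorSum-delta []      s       = refl
xorSum-delta {suc n} (a ∷ x) zero = trans (cong ((a ∧ true) xor_)
    (trans (xorSum-cong n (λ i → BP.∧-zeroʳ (at x i))) (xorSum-false n)))
  (trans (BP.xor-identityʳ _) (BP.∧-identityʳ a))
xorSum-delta (a ∷ x) (suc s) = trans (cong ((a ∧ false) xor_) (xorSum-delta x s)) (cong (_xor at x s) (BP.∧-zeroʳ a))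

select₁ : ∀ {n} (x : Vec Bool n) (c : ℕ → Bool) s → (∀ i → c i ≡ (i ≡ᵇ s)) →
  xorSum n (λ i → at x i ∧ c i) ≡ at x s
select₁ {n} x c s hc = trans (xorSum-cong n (λ i → cong (at x i ∧_) (hc i))) (xorSum-delta x s)

select₂ : ∀ {n} (x : Vec Bool n) (c : ℕ → Bool) s s' → (∀ i → c i ≡ (i ≡ᵇ s) xor (i ≡ᵇ s')) →
  xorSum n (λ i → at x i ∧ c i) ≡ at x s xor at x s'
select₂ {n} x c s s' hc = begin
    xorSum n (λ i → at x i ∧ c i)
      ≡⟨ xorSum-cong n (λ i → trans (cong (at x i ∧_) (hc i)) (BP.∧-distribˡ-xor (at x i) _ _)) ⟩
    xorSum n (λ i → (at x i ∧ (i ≡ᵇ s)) xor (at x i ∧ (i ≡ᵇ s')))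
      ≡⟨ xorSum-xor n _ _ ⟩
    xorSum n (λ i → at x i ∧ (i ≡ᵇ s)) xor xorSum n (λ i → at x i ∧ (i ≡ᵇ s'))
      ≡⟨ cong₂ _xor_ (xorSum-delta x s) (xorSum-delta x s') ⟩
    at x s xor at x s' ∎
  where open ≡-Reasoning

foldr-tabulate : ∀ n (h : ℕ → Bool) → foldr _xor_ false (L.tabulate {n = n} (λ i → h (toℕ i))) ≡ xorSum n h
foldr-tabulate zero    h = refl
foldr-tabulate (suc n) h = cong (h 0 xor_) (foldr-tabulate n (λ i → h (suc i)))

blockEntry : ℕ → ℕ → Bool
blockEntry i j = ((i N./ 2) ≡ᵇ (j N./ 2)) ∧ not (((i N.% 2) ≡ᵇ 0) ∧ ((j N.% 2) ≡ᵇ 0))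

Aℕ : ℕ → ℕ → ℕ → Bool
Aℕ n i j with i <ᵇ n | j <ᵇ n
... | true  | true  = blockEntry i j
... | false | false = i ≡ᵇ j
... | _     | _     = false

A-Aℕ : ∀ v f (i j : Fin v) → A v f i j ≡ Aℕ (v ∸ f) (toℕ i) (toℕ j)
A-Aℕ v f i j with toℕ i <ᵇ (v ∸ f) | toℕ j <ᵇ (v ∸ f)
... | true  | true  = refl
... | false | false = refl
... | true  | false = refl
... | false | true  = refl

div2 : ∀ i → (2 + i) N./ 2 ≡ suc (i N./ 2)
div2 i = DM.+-distrib-/-∣ˡ {2} i {2} (divides 1 refl)

mod2 : ∀ i → (2 + i) N.% 2 ≡ i N.% 2
mod2 i = trans (cong (N._% 2) (NP.+-comm 2 i)) (DM.[m+n]%n≡m%n i 2)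

blockEntry-shift : ∀ i j → blockEntry (2 + i) (2 + j) ≡ blockEntry i j
blockEntry-shift i j rewrite div2 i | div2 j | mod2 i | mod2 j = refl

blockEntry-0s : ∀ j → blockEntry 0 (2 + j) ≡ false
blockEntry-0s j rewrite div2 j = refl

blockEntry-1s : ∀ j → blockEntry 1 (2 + j) ≡ false
blockEntry-1s j rewrite div2 j = refl

blockEntry-s0 : ∀ i → blockEntry (2 + i) 0 ≡ false
blockEntry-s0 i rewrite div2 i = refl

blockEntry-s1 : ∀ i → blockEntry (2 + i) 1 ≡ false
blockEntry-s1 i rewrite div2 i = refl

blockEntry-even : ∀ m i → blockEntry i (m * 2) ≡ (i ≡ᵇ suc (m * 2))
blockEntry-even zero zero = refl
blockEntry-even zero (suc zero) = refl
blockEntry-even zero (suc (suc i)) = blockEntry-s0 i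
blockEntry-even (suc m) zero = blockEntry-0s (m * 2)
blockEntry-even (suc m) (suc zero) = blockEntry-1s (m * 2)
blockEntry-even (suc m) (suc (suc i)) = trans (blockEntry-shift i (m * 2)) (blockEntry-even m i)

blockEntry-odd : ∀ m i → blockEntry i (suc (m * 2)) ≡ (i ≡ᵇ m * 2) xor (i ≡ᵇ suc (m * 2))
blockEntry-odd zero zero = refl
blockEntry-odd zero (suc zero) = refl
blockEntry-odd zero (suc (suc i)) = blockEntry-s1 i
blockEntry-odd (suc m) zero = blockEntry-0s (suc (m * 2))
blockEntry-odd (suc m) (suc zero) = blockEntry-1s (suc (m * 2))
blockEntry-odd (suc m) (suc (suc i)) = trans (blockEntry-shift i (suc (m * 2))) (blockEntry-odd m i)

<ᵇ-true : ∀ {i n} → i < n → (i <ᵇ n) ≡ true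
<ᵇ-true {zero} {suc n} _ = refl
<ᵇ-true {suc i} {suc n} (s≤s h) = <ᵇ-true h

<ᵇ-false : ∀ {i n} → n ≤ i → (i <ᵇ n) ≡ false
<ᵇ-false {i} {zero} _ = refl
<ᵇ-false {suc i} {suc n} (s≤s h) = <ᵇ-false h

≡ᵇ-false : ∀ {i j} → i ≢ j → (i ≡ᵇ j) ≡ false
≡ᵇ-false {zero} {zero} h = ⊥-elim (h refl)
≡ᵇ-false {zero} {suc j} h = refl
≡ᵇ-false {suc i} {zero} h = refl
≡ᵇ-false {suc i} {suc j} h = ≡ᵇ-false (λ e → h (cong suc e))

≡ᵇ-far : ∀ {i s n} → s < n → n ≤ i → (i ≡ᵇ s) ≡ false
≡ᵇ-far s<n n≤i = ≡ᵇ-false (λ e → NP.<-irrefl refl (NP.<-≤-trans (subst (_< _) (sym e) s<n) n≤i))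

≮ᵇ⇒≥ : ∀ i n → (i <ᵇ n) ≡ false → n ≤ i
≮ᵇ⇒≥ i       zero    e = z≤n
≮ᵇ⇒≥ zero    (suc n) ()
≮ᵇ⇒≥ (suc i) (suc n) e = s≤s (≮ᵇ⇒≥ i n e)

even-suc< : ∀ m q → m * 2 < q * 2 → suc (m * 2) < q * 2
even-suc< zero    (suc q) h                 = s≤s (s≤s z≤n)
even-suc< (suc m) (suc q) (s≤s (s≤s h)) = s≤s (s≤s (even-suc< m q h))

parity : ∀ t → ∃[ m ] (t ≡ m * 2 ⊎ t ≡ suc (m * 2))
parity zero = 0 , inj₁ refl
parity (suc t) with parity t
... | m , inj₁ refl = m , inj₂ refl
... | m , inj₂ refl = suc m , inj₁ refl

A-column-outer : ∀ n t → n ≤ t → ∀ i → Aℕ n i t ≡ (i ≡ᵇ t)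
A-column-outer n t n≤t i with i <ᵇ n in ei | t <ᵇ n in et
... | _     | true  = ⊥-elim (case trans (sym et) (<ᵇ-false n≤t) of λ ())
... | false | false = refl
... | true  | false = sym (≡ᵇ-false (λ e → NP.<-irrefl e (NP.<-≤-trans (NP.<ᵇ⇒< i n (subst T (sym ei) tt)) n≤t)))

A-column-block : ∀ n t → t < n → ∀ i → Aℕ n i t ≡ (if i <ᵇ n then blockEntry i t else false)
A-column-block n t t<n i with i <ᵇ n | t <ᵇ n in et
... | _     | false = ⊥-elim (case trans (sym et) (<ᵇ-true t<n) of λ ())
... | true  | true  = refl
... | false | true  = refl

A-column-even : ∀ q m → m * 2 < q * 2 → ∀ i → Aℕ (q * 2) i (m * 2) ≡ (i ≡ᵇ suc (m * 2))
A-column-even q m t< i = trans (A-column-block (q * 2) _ t< i) inner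
  where
  inner : (if i <ᵇ q * 2 then blockEntry i (m * 2) else false) ≡ (i ≡ᵇ suc (m * 2))
  inner with i <ᵇ q * 2 in ei
  ... | true  = blockEntry-even m i
  ... | false = sym (≡ᵇ-far (even-suc< m q t<) (≮ᵇ⇒≥ i _ ei))

A-column-odd : ∀ q m → suc (m * 2) < q * 2 → ∀ i →
  Aℕ (q * 2) i (suc (m * 2)) ≡ (i ≡ᵇ m * 2) xor (i ≡ᵇ suc (m * 2))
A-column-odd q m t< i = trans (A-column-block (q * 2) _ t< i) inner
  where
  inner : (if i <ᵇ q * 2 then blockEntry i (suc (m * 2)) else false) ≡ (i ≡ᵇ m * 2) xor (i ≡ᵇ suc (m * 2))
  inner with i <ᵇ q * 2 in ei
  ... | true  = blockEntry-odd m i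
  ... | false = sym (cong₂ _xor_ (≡ᵇ-far (NP.<-trans (NP.n<1+n _) t<) (≮ᵇ⇒≥ i _ ei)) (≡ᵇ-far t< (≮ᵇ⇒≥ i _ ei)))

at-++ˡ : ∀ {m k} (x : V m) (w : V k) t → t < m → at (x ++ w) t ≡ at x t
at-++ˡ (a ∷ x) w zero    h       = refl
at-++ˡ (a ∷ x) w (suc t) (s≤s h) = at-++ˡ x w t h

at-++ʳ : ∀ {m k} (x y : V m) (w : V k) t → m ≤ t → at (x ++ w) t ≡ at (y ++ w) t
at-++ʳ []      []      w t       _       = refl
at-++ʳ (a ∷ x) (b ∷ y) w (suc t) (s≤s h) = at-++ʳ x y w t h

at-rot-even : ∀ q (u : V (q * 2)) m → at (rot q u) (m * 2) ≡ at u (suc (m * 2))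
at-rot-even zero    []          m       = refl
at-rot-even (suc q) (a ∷ b ∷ u) zero    = refl
at-rot-even (suc q) (a ∷ b ∷ u) (suc m) = at-rot-even q u m

at-rot-odd : ∀ q (u : V (q * 2)) m → at (rot q u) (suc (m * 2)) ≡ at u (m * 2) xor at u (suc (m * 2))
at-rot-odd zero    []          m       = refl
at-rot-odd (suc q) (a ∷ b ∷ u) zero    = refl
at-rot-odd (suc q) (a ∷ b ∷ u) (suc m) = at-rot-odd q u m

column-of-product : ∀ q f (u : V (q * 2)) (w : V f) t →
  xorSum (q * 2 + f) (λ i → at (u ++ w) i ∧ Aℕ (q * 2) i t) ≡ at (rot q u ++ w) t
column-of-product q f u w t with t N.<? q * 2
... | no t≮ = trans (select₁ (u ++ w) _ t (A-column-outer (q * 2) t n≤t)) (at-++ʳ u (rot q u) w t n≤t)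
  where n≤t = NP.≮⇒≥ t≮
... | yes t< with parity t
... | m , inj₁ refl = begin
    xorSum (q * 2 + f) (λ i → at (u ++ w) i ∧ Aℕ (q * 2) i t) ≡⟨ select₁ (u ++ w) _ _ (A-column-even q m t<) ⟩
    at (u ++ w) (suc t)                                        ≡⟨ at-++ˡ u w _ (even-suc< m q t<) ⟩
    at u (suc t)                                               ≡⟨ sym (at-rot-even q u m) ⟩
    at (rot q u) t                                             ≡⟨ sym (at-++ˡ (rot q u) w t t<) ⟩
    at (rot q u ++ w) t ∎
  where open ≡-Reasoning
... | m , inj₂ refl = begin
    xorSum (q * 2 + f) (λ i → at (u ++ w) i ∧ Aℕ (q * 2) i t) ≡⟨ select₂ (u ++ w) _ _ _ (A-column-odd q m t<) ⟩
    at (u ++ w) (m * 2) xor at (u ++ w) t   ≡⟨ cong₂ _xor_ (at-++ˡ u w _ (NP.<-trans (NP.n<1+n _) t<)) (at-++ˡ u w _ t<) ⟩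
    at u (m * 2) xor at u t                 ≡⟨ sym (at-rot-odd q u m) ⟩
    at (rot q u) t                          ≡⟨ sym (at-++ˡ (rot q u) w t t<) ⟩
    at (rot q u ++ w) t ∎
  where open ≡-Reasoning

mul-A : ∀ q f (u : V (q * 2)) (w : V f) → (u ++ w) ·ᴹ A (q * 2 + f) f ≡ rot q u ++ w
mul-A q f u w = trans (VecP.tabulate-cong column) (VecP.tabulate∘lookup (rot q u ++ w))
  where
  v : ℕ
  v = q * 2 + f
  x : V v
  x = u ++ w
  column : ∀ j → foldr _xor_ false (map (λ i → lookup x i ∧ A v f i j) (allFin v)) ≡ lookup (rot q u ++ w) j
  column j = begin
      foldr _xor_ false (map (λ i → lookup x i ∧ A v f i j) (allFin v))
        ≡⟨ cong (foldr _xor_ false) (LP.map-tabulate (λ i → i) (λ i → lookup x i ∧ A v f i j)) ⟩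
      foldr _xor_ false (L.tabulate (λ i → lookup x i ∧ A v f i j))
        ≡⟨ cong (foldr _xor_ false) (LP.tabulate-cong (λ i → cong₂ _∧_ (lookup-at x i)
              (trans (A-Aℕ v f i j) (cong (λ z → Aℕ z (toℕ i) (toℕ j)) (NP.m+n∸n≡m (q * 2) f))))) ⟩
      foldr _xor_ false (L.tabulate {n = v} (λ i → at x (toℕ i) ∧ Aℕ (q * 2) (toℕ i) (toℕ j)))
        ≡⟨ foldr-tabulate v (λ i → at x i ∧ Aℕ (q * 2) i (toℕ j)) ⟩
      xorSum v (λ i → at x i ∧ Aℕ (q * 2) i (toℕ j))
        ≡⟨ column-of-product q f u w (toℕ j) ⟩
      at (rot q u ++ w) (toℕ j)
        ≡⟨ sym (lookup-at (rot q u ++ w) j) ⟩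
      lookup (rot q u ++ w) j ∎
    where open ≡-Reasoning

-- An echelon basis of a d-dimensional subspace of
-- F₂^f is a list of d rows together with the mask m of pivot columns; each
-- row has a 1 in its own pivot column and 0 in the other pivot columns.
-- Enumerating them recursively on the first column (pivot or not) gives a
-- duplicate-free list echelons d f in bijection with the d-dimensional
-- subspaces: every independent family has exactly one echelon basis of the
-- same span.  Its length gauss d f obeys the Gaussian-binomial recursion, and
-- the existence part also gives the dimension bound (more than f vectors of
-- F₂^f are dependent).

pairsOver : ∀ {A C : Set} → List A → (A → List C) → List (A × C)
pairsOver [] g = []
pairsOver (x ∷ xs) g = map (x ,_) (g x) L.++ pairsOver xs g

pairsOver-∈⁺ : ∀ {A C : Set} {xs : List A} {g : A → List C} {x c} → x ∈ xs → c ∈ g x → (x , c) ∈ pairsOver xs g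
pairsOver-∈⁺ {xs = x ∷ xs} {g} (here refl) c∈ = ∈-++⁺ˡ (∈-map⁺ (x ,_) c∈)
pairsOver-∈⁺ {xs = x ∷ xs} {g} (there x∈) c∈ = ∈-++⁺ʳ (map (x ,_) (g x)) (pairsOver-∈⁺ x∈ c∈)

pairsOver-∈⁻ : ∀ {A C : Set} (xs : List A) (g : A → List C) {x c} → (x , c) ∈ pairsOver xs g → x ∈ xs × c ∈ g x
pairsOver-∈⁻ (y ∷ xs) g h with ∈-++⁻ (map (y ,_) (g y)) h
... | inj₂ h' = let (a , b) = pairsOver-∈⁻ xs g h' in there a , b
... | inj₁ h' with ∈-map⁻ (y ,_) h'
... | c' , c∈ , refl = here refl , c∈

pairsOver-unique : ∀ {A C : Set} {xs : List A} {g : A → List C} → Unique xs → (∀ x → Unique (g x)) → Unique (pairsOver xs g)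
pairsOver-unique {xs = []} u ug = []
pairsOver-unique {xs = x ∷ xs} {g} (px ∷ u) ug =
  ++⁺ (map⁺ (λ e → cong proj₂ e) (ug x)) (pairsOver-unique u ug)
    (λ (a , b) → case ∈-map⁻ (x ,_) a of λ where
       (c , _ , refl) → All.lookup px (proj₁ (pairsOver-∈⁻ xs g b)) refl)

pairsOver-length : ∀ {A C : Set} (xs : List A) (g : A → List C) k → (∀ x → x ∈ xs → length (g x) ≡ k) →
  length (pairsOver xs g) ≡ length xs * k
pairsOver-length [] g k h = refl
pairsOver-length (x ∷ xs) g k h = begin
    length (map (x ,_) (g x) L.++ pairsOver xs g)   ≡⟨ LP.length-++ (map (x ,_) (g x)) ⟩
    length (map (x ,_) (g x)) + length (pairsOver xs g) ≡⟨ cong₂ _+_ (trans (LP.length-map _ (g x)) (h x (here refl)))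
                                                       (pairsOver-length xs g k (λ y y∈ → h y (there y∈))) ⟩
    k + length xs * k ∎
  where open ≡-Reasoning

-- the vectors vanishing at the pivot positions marked by m
reduced : ∀ {f} → Vec Bool f → List (V f)
reduced [] = [] ∷ []
reduced (true ∷ m) = map (false ∷_) (reduced m)
reduced (false ∷ m) = map (false ∷_) (reduced m) L.++ map (true ∷_) (reduced m)

pivotCoords : ∀ {f} → Vec Bool f → V f → List Bool
pivotCoords [] [] = []
pivotCoords (true ∷ m) (y ∷ ys) = y ∷ pivotCoords m ys
pivotCoords (false ∷ m) (y ∷ ys) = pivotCoords m ys

pivotCoords-reduced : ∀ {f} (m : Vec Bool f) {r} → r ∈ reduced m → ∀ y → pivotCoords m (r ⊕ y) ≡ pivotCoords m y
pivotCoords-reduced [] (here refl) [] = refl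
pivotCoords-reduced (true ∷ m) h (y ∷ ys) with ∈-map⁻ (false ∷_) h
... | r' , r∈ , refl = cong (y ∷_) (pivotCoords-reduced m r∈ ys)
pivotCoords-reduced (false ∷ m) h (y ∷ ys) with ∈-++⁻ (map (false ∷_) (reduced m)) h
... | inj₁ h' with ∈-map⁻ (false ∷_) h'
... | r' , r∈ , refl = pivotCoords-reduced m r∈ ys
pivotCoords-reduced (false ∷ m) h (y ∷ ys) | inj₂ h' with ∈-map⁻ (true ∷_) h'
... | r' , r∈ , refl = pivotCoords-reduced m r∈ ys

Echelon : ℕ → ℕ → Set
Echelon d f = Vec (V f) d × Vec Bool f

nonPivot : ∀ {d f} → Echelon d f → Echelon d (suc f)
nonPivot (R , m) = V.map (false ∷_) R , false ∷ m

pivot : ∀ {d f} → Echelon d f × V f → Echelon (suc d) (suc f)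
pivot ((T , m) , r) = (true ∷ r) ∷ V.map (false ∷_) T , true ∷ m

echelons : (d f : ℕ) → List (Echelon d f)
echelons zero f = ([] , replicate f false) ∷ []
echelons (suc d) zero = []
echelons (suc d) (suc f) = map nonPivot (echelons (suc d) f) L.++ map pivot (pairsOver (echelons d f) (λ p → reduced (proj₂ p)))

nonPivot≢pivot : ∀ {d f} {p : Echelon (suc d) f} {q : Echelon d f × V f} → nonPivot p ≢ pivot q
nonPivot≢pivot ()

echelons-∈⁻ : ∀ {d f} {p : Echelon (suc d) (suc f)} → p ∈ echelons (suc d) (suc f) →
  (∃[ p' ] (p' ∈ echelons (suc d) f × p ≡ nonPivot p')) ⊎ (∃[ p' ] ∃[ r ] (p' ∈ echelons d f × r ∈ reduced (proj₂ p') × p ≡ pivot (p' , r)))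
echelons-∈⁻ {d} {f} h with ∈-++⁻ (map nonPivot (echelons (suc d) f)) h
... | inj₁ h' with ∈-map⁻ nonPivot h'
... | p' , p∈ , e = inj₁ (p' , p∈ , e)
echelons-∈⁻ {d} {f} h | inj₂ h' with ∈-map⁻ pivot h'
... | (p' , r) , pr∈ , e = let (a , b) = pairsOver-∈⁻ (echelons d f) (λ p → reduced (proj₂ p)) pr∈ in inj₂ (p' , r , a , b , e)

combo-pivot : ∀ {f d} (c0 : Bool) (c : Vec Bool d) (r : V f) (T : Vec (V f) d) →
  combo (c0 ∷ c) ((true ∷ r) ∷ V.map (false ∷_) T) ≡ c0 ∷ ((c0 · r) ⊕ combo c T)
combo-pivot true c r T = cong ((true ∷ r) ⊕_) (combo-0∷ c T)
combo-pivot false c r T = trans (combo-0∷ c T) (cong (false ∷_) (sym (⊕-identityˡ _)))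

toList-injective : ∀ {n} (x y : Vec Bool n) → V.toList x ≡ V.toList y → x ≡ y
toList-injective [] [] e = refl
toList-injective (a ∷ x) (b ∷ y) e = cong₂ _∷_ (LP.∷-injectiveˡ e) (toList-injective x y (LP.∷-injectiveʳ e))

pivotCoords-combo : ∀ {d f} {p : Echelon d f} → p ∈ echelons d f → ∀ c → pivotCoords (proj₂ p) (combo c (proj₁ p)) ≡ V.toList c
pivotCoords-combo {zero} {f} (here refl) [] = noPivotCoords f
  where noPivotCoords : ∀ f → pivotCoords (replicate f false) (0v {f}) ≡ []
        noPivotCoords zero = refl
        noPivotCoords (suc f) = noPivotCoords f
pivotCoords-combo {suc d} {zero} ()
pivotCoords-combo {suc d} {suc f} h c with echelons-∈⁻ h
... | inj₁ ((R , m) , p∈ , refl) = trans (cong (pivotCoords (false ∷ m)) (combo-0∷ c R)) (pivotCoords-combo p∈ c)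
... | inj₂ ((T , m) , r , p∈ , r∈ , refl) with c
... | true ∷ c' = trans (cong (pivotCoords (true ∷ m)) (combo-pivot true c' r T)) (cong (true ∷_) (trans (pivotCoords-reduced m r∈ _) (pivotCoords-combo p∈ c')))
... | false ∷ c' = trans (cong (pivotCoords (true ∷ m)) (combo-0∷ c' T)) (cong (false ∷_) (pivotCoords-combo p∈ c'))

echelon-independent : ∀ {d f} {p : Echelon d f} → p ∈ echelons d f → LinIndep (proj₁ p)
echelon-independent {d} {p = R , m} h c e = toList-injective c _ (begin
    V.toList c                      ≡⟨ sym (pivotCoords-combo h c) ⟩
    pivotCoords m (combo c R)          ≡⟨ cong (pivotCoords m) (trans e (sym (combo-zeroˡ R))) ⟩
    pivotCoords m (combo (replicate d false) R)  ≡⟨ pivotCoords-combo h _ ⟩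
    V.toList (replicate d false) ∎)
  where open ≡-Reasoning

echelon-reduce : ∀ {d f} {p : Echelon d f} → p ∈ echelons d f → ∀ w → ∃[ r ] (r ∈ reduced (proj₂ p) × ∃[ c ] w ≡ r ⊕ combo c (proj₁ p))
echelon-reduce {zero} {f} (here refl) w = w , all-reduced w , [] , sym (⊕-identityʳ w)
  where all-reduced : ∀ {f} (w : V f) → w ∈ reduced (replicate f false)
        all-reduced [] = here refl
        all-reduced {suc f} (false ∷ w) = ∈-++⁺ˡ (∈-map⁺ (false ∷_) (all-reduced w))
        all-reduced {suc f} (true ∷ w) = ∈-++⁺ʳ (map (false ∷_) (reduced (replicate f false))) (∈-map⁺ (true ∷_) (all-reduced w))
echelon-reduce {suc d} {zero} ()
echelon-reduce {suc d} {suc f} h (w0 ∷ ws) with echelons-∈⁻ h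
... | inj₁ ((R , m) , p∈ , refl) with echelon-reduce p∈ ws
... | r , r∈ , c , e = w0 ∷ r , reduced-nonPivot w0 r∈ , c ,
        trans (cong (w0 ∷_) e) (sym (trans (cong ((w0 ∷ r) ⊕_) (combo-0∷ c R)) (cong (_∷ (r ⊕ combo c R)) (BP.xor-identityʳ w0))))
  where reduced-nonPivot : ∀ b {r} → r ∈ reduced m → (b ∷ r) ∈ reduced (false ∷ m)
        reduced-nonPivot false r∈ = ∈-++⁺ˡ (∈-map⁺ (false ∷_) r∈)
        reduced-nonPivot true r∈ = ∈-++⁺ʳ (map (false ∷_) (reduced m)) (∈-map⁺ (true ∷_) r∈)
echelon-reduce {suc d} {suc f} h (w0 ∷ ws) | inj₂ ((T , m) , t , p∈ , t∈ , refl) with echelon-reduce p∈ (ws ⊕ (w0 · t))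
... | r , r∈ , c , e = false ∷ r , ∈-map⁺ (false ∷_) r∈ , w0 ∷ c ,
        trans (cong (w0 ∷_) eq) (sym (cong ((false ∷ r) ⊕_) (combo-pivot w0 c t T)))
  where
  eq : ws ≡ r ⊕ ((w0 · t) ⊕ combo c T)
  eq = begin
      ws                                  ≡⟨ sym (⊕-identityʳ ws) ⟩
      ws ⊕ 0v                             ≡⟨ cong (ws ⊕_) (sym (⊕-self (w0 · t))) ⟩
      ws ⊕ ((w0 · t) ⊕ (w0 · t))          ≡⟨ sym (⊕-assoc ws _ _) ⟩
      (ws ⊕ (w0 · t)) ⊕ (w0 · t)          ≡⟨ cong (_⊕ (w0 · t)) e ⟩
      (r ⊕ combo c T) ⊕ (w0 · t)          ≡⟨ ⊕-assoc r _ _ ⟩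
      r ⊕ (combo c T ⊕ (w0 · t))          ≡⟨ cong (r ⊕_) (⊕-comm _ _) ⟩
      r ⊕ ((w0 · t) ⊕ combo c T) ∎
    where open ≡-Reasoning

span-0∷⁺ : ∀ {f d} (R : Vec (V f) d) {t} → InSpan R t → InSpan (V.map (false ∷_) R) (false ∷ t)
span-0∷⁺ R (c , refl) = c , combo-0∷ c R

span-0∷⁻ : ∀ {f d} (R : Vec (V f) d) {t b} → InSpan (V.map (false ∷_) R) (b ∷ t) → (b ≡ false) × InSpan R t
span-0∷⁻ R (c , e) with trans (sym (combo-0∷ c R)) e
... | refl = refl , c , refl

span-pivot⁻ : ∀ {f d} (r : V f) (T : Vec (V f) d) {t b} → InSpan ((true ∷ r) ∷ V.map (false ∷_) T) (b ∷ t) →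
  ∃[ c ] (t ≡ (b · r) ⊕ combo c T)
span-pivot⁻ r T ((c0 ∷ c) , e) with trans (sym (combo-pivot c0 c r T)) e
... | refl = c , refl

-- reduced vectors that differ by an element of the span are equal,
-- since both have the same (zero) pivot coordinates
reduced-difference : ∀ {d f} {p : Echelon d f} → p ∈ echelons d f → ∀ {r r'} (c : Vec Bool d) →
  r ∈ reduced (proj₂ p) → r' ∈ reduced (proj₂ p) → r ≡ r' ⊕ combo c (proj₁ p) → r ≡ r'
reduced-difference {d} {p = T , m} p∈ {r} {r'} c r∈ r'∈ e =
  ⊕≡0⇒≡ r r' (trans difference (trans (cong (λ z → combo z T) c≡0) (combo-zeroˡ T)))
  where
  open ≡-Reasoning
  difference : r ⊕ r' ≡ combo c T
  difference = begin
      r ⊕ r'                   ≡⟨ cong (_⊕ r') e ⟩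
      (r' ⊕ combo c T) ⊕ r'    ≡⟨ ⊕-comm _ r' ⟩
      r' ⊕ (r' ⊕ combo c T)    ≡⟨ sym (⊕-assoc r' r' _) ⟩
      (r' ⊕ r') ⊕ combo c T    ≡⟨ cong (_⊕ combo c T) (⊕-self r') ⟩
      0v ⊕ combo c T           ≡⟨ ⊕-identityˡ _ ⟩
      combo c T ∎
  c≡0 : c ≡ replicate d false
  c≡0 = toList-injective c _ (begin
      V.toList c                              ≡⟨ sym (pivotCoords-combo p∈ c) ⟩
      pivotCoords m (combo c T)               ≡⟨ cong (pivotCoords m) (sym difference) ⟩
      pivotCoords m (r ⊕ r')                  ≡⟨ pivotCoords-reduced m r∈ r' ⟩
      pivotCoords m r'                        ≡⟨ cong (pivotCoords m) (sym (⊕-identityʳ r')) ⟩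
      pivotCoords m (r' ⊕ 0v)                 ≡⟨ pivotCoords-reduced m r'∈ 0v ⟩
      pivotCoords m 0v                        ≡⟨ cong (pivotCoords m) (sym (combo-zeroˡ T)) ⟩
      pivotCoords m (combo (replicate d false) T) ≡⟨ pivotCoords-combo p∈ _ ⟩
      V.toList (replicate d false) ∎)

echelon-unique : ∀ {d f} {p q : Echelon d f} → p ∈ echelons d f → q ∈ echelons d f →
  proj₁ p ⊑ proj₁ q → proj₁ q ⊑ proj₁ p → p ≡ q
echelon-unique {zero} (here refl) (here refl) a b = refl
echelon-unique {suc d} {zero} ()
echelon-unique {suc d} {suc f} hp hq a b with echelons-∈⁻ hp | echelons-∈⁻ hq
... | inj₁ ((R1 , m1) , p1 , refl) | inj₁ ((R2 , m2) , p2 , refl) =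
  cong nonPivot (echelon-unique p1 p2 (sub R1 R2 a) (sub R2 R1 b))
  where
  sub : ∀ X Y → V.map (false ∷_) X ⊑ V.map (false ∷_) Y → X ⊑ Y
  sub X Y h t s = proj₂ (span-0∷⁻ Y (h (false ∷ t) (span-0∷⁺ X s)))
... | inj₁ ((R1 , m1) , p1 , refl) | inj₂ ((T2 , m2) , r2 , p2 , r2∈ , refl) =
  case proj₁ (span-0∷⁻ R1 (b (true ∷ r2) (span-gen ((true ∷ r2) ∷ V.map (false ∷_) T2) F.zero))) of λ ()
... | inj₂ ((T1 , m1) , r1 , p1 , r1∈ , refl) | inj₁ ((R2 , m2) , p2 , refl) =
  case proj₁ (span-0∷⁻ R2 (a (true ∷ r1) (span-gen ((true ∷ r1) ∷ V.map (false ∷_) T1) F.zero))) of λ ()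
... | inj₂ ((T1 , m1) , r1 , p1 , r1∈ , refl) | inj₂ ((T2 , m2) , r2 , p2 , r2∈ , refl)
  with echelon-unique p1 p2 (sub r1 r2 T1 T2 a) (sub r2 r1 T2 T1 b)
  where
  sub : ∀ r r' X Y → ((true ∷ r) ∷ V.map (false ∷_) X) ⊑ ((true ∷ r') ∷ V.map (false ∷_) Y) → X ⊑ Y
  sub r r' X Y h t (c , refl) with span-pivot⁻ r' Y (h (false ∷ combo c X) (false ∷ c , combo-0∷ c X))
  ... | c' , e = c' , sym (trans e (⊕-identityˡ _))
... | refl with span-pivot⁻ r2 T2 (a (true ∷ r1) (span-gen ((true ∷ r1) ∷ V.map (false ∷_) T1) F.zero))
... | c , e = cong (λ r → pivot ((T1 , m1) , r)) (reduced-difference p1 c r1∈ r2∈ e)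

-- Existence of an echelon basis for an independent family, by induction on
-- the number of columns: if some combination has first coordinate 1, make it
-- the pivot row and clear the first column of the other rows (PivotStep);
-- otherwise the first column is zero (zeroColumnStep).
-- first coordinate, and the remaining coordinates of a family
hd : ∀ {f} → V (suc f) → Bool
hd = V.head

tails : ∀ {f d} → Vec (V (suc f)) d → Vec (V f) d
tails = V.map V.tail

hd-⊕ : ∀ {f} (x y : V (suc f)) → hd (x ⊕ y) ≡ hd x xor hd y
hd-⊕ (a ∷ x) (b ∷ y) = refl

hd-· : ∀ {f} (c : Bool) (x : V (suc f)) → hd (c · x) ≡ c ∧ hd x
hd-· true x = refl
hd-· false x = refl

tl-combo : ∀ {f d} (c : Vec Bool d) (B : Vec (V (suc f)) d) → V.tail (combo c B) ≡ combo c (tails B)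
tl-combo = combo-map V.tail (λ { (a ∷ x) (b ∷ y) → refl }) refl

combo-split : ∀ {f d} (c : Vec Bool d) (B : Vec (V (suc f)) d) → combo c B ≡ hd (combo c B) ∷ combo c (tails B)
combo-split c B with combo c B | tl-combo c B
... | (x0 ∷ x) | e = cong (x0 ∷_) e

HasEchelons : ℕ → Set
HasEchelons f = ∀ d (B : Vec (V f) d) → LinIndep B →
  ∃[ p ] (p ∈ echelons d f × proj₁ p ⊑ B × B ⊑ proj₁ p)

-- b has first coordinate 1: subtract multiples of b to clear the first column
module PivotStep {f d} (b : V (suc f)) (hb : hd b ≡ true) (Bs : Vec (V (suc f)) d) where
  clear : V (suc f) → V (suc f)
  clear x = x ⊕ (hd x · b)

  cleared : Vec (V (suc f)) d
  cleared = V.map clear Bs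
  rest : Vec (V f) d
  rest = tails cleared

  hd-·pivot : ∀ a → hd (a · b) ≡ a
  hd-·pivot a = trans (hd-· a b) (trans (cong (a ∧_) hb) (BP.∧-identityʳ a))

  combo-cleared : ∀ cs → combo cs cleared ≡ combo cs Bs ⊕ (hd (combo cs Bs) · b)
  combo-cleared cs = go cs Bs
    where
    go : ∀ {k} (cs : Vec Bool k) (Xs : Vec (V (suc f)) k) → combo cs (V.map clear Xs) ≡ combo cs Xs ⊕ (hd (combo cs Xs) · b)
    go [] [] = sym (⊕-self 0v)
    go (false ∷ cs) (x ∷ Xs) = go cs Xs
    go (true ∷ cs) (x ∷ Xs) = begin
        (x ⊕ (hd x · b)) ⊕ combo cs (V.map clear Xs)     ≡⟨ cong ((x ⊕ (hd x · b)) ⊕_) (go cs Xs) ⟩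
        (x ⊕ (hd x · b)) ⊕ (C ⊕ (hd C · b))            ≡⟨ ⊕-interchange x _ C _ ⟩
        (x ⊕ C) ⊕ ((hd x · b) ⊕ (hd C · b))            ≡⟨ cong ((x ⊕ C) ⊕_) (sym (xor-· (hd x) (hd C) b)) ⟩
        (x ⊕ C) ⊕ ((hd x xor hd C) · b)                ≡⟨ cong (λ z → (x ⊕ C) ⊕ (z · b)) (sym (hd-⊕ x C)) ⟩
        (x ⊕ C) ⊕ (hd (x ⊕ C) · b) ∎
      where open ≡-Reasoning
            C = combo cs Xs

  hd-cleared : ∀ cs → hd (combo cs cleared) ≡ false
  hd-cleared cs = trans (cong hd (combo-cleared cs)) (trans (hd-⊕ (combo cs Bs) _)
    (trans (cong (hd (combo cs Bs) xor_) (hd-·pivot (hd (combo cs Bs)))) (BP.xor-same (hd (combo cs Bs)))))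

  combo-cleared-0∷ : ∀ cs → combo cs cleared ≡ false ∷ combo cs rest
  combo-cleared-0∷ cs = trans (combo-split cs cleared) (cong (_∷ combo cs rest) (hd-cleared cs))

  rest-independent : LinIndep (b ∷ Bs) → LinIndep rest
  rest-independent ind cs e = VecP.∷-injectiveʳ (ind (σ ∷ cs) (begin
      combo (σ ∷ cs) (b ∷ Bs)     ≡⟨ combo-∷ σ cs b Bs ⟩
      (σ · b) ⊕ combo cs Bs        ≡⟨ ⊕-comm _ _ ⟩
      combo cs Bs ⊕ (σ · b)        ≡⟨ sym (combo-cleared cs) ⟩
      combo cs cleared                 ≡⟨ combo-cleared-0∷ cs ⟩
      false ∷ combo cs rest           ≡⟨ cong (false ∷_) e ⟩
      0v ∎))
    where open ≡-Reasoning
          σ : Bool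
          σ = hd (combo cs Bs)

  rest⊑ : ∀ t → InSpan rest t → InSpan (b ∷ Bs) (false ∷ t)
  rest⊑ t (g , refl) = hd (combo g Bs) ∷ g , (begin
      combo (hd (combo g Bs) ∷ g) (b ∷ Bs)   ≡⟨ combo-∷ _ g b Bs ⟩
      (hd (combo g Bs) · b) ⊕ combo g Bs     ≡⟨ ⊕-comm _ _ ⟩
      combo g Bs ⊕ (hd (combo g Bs) · b)     ≡⟨ sym (combo-cleared g) ⟩
      combo g cleared                            ≡⟨ combo-cleared-0∷ g ⟩
      false ∷ combo g rest ∎)
    where open ≡-Reasoning

  -- given an echelon basis R of span rest and b = 1 ∷ (r + combo e R) with r
  -- reduced, the new basis (1 ∷ r) ∷ (0 ∷ R) spans the same space as b ∷ Bs
  module NewBasis (R : Vec (V f) d) (r : V f) (e : Vec Bool d)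
      (RT : R ⊑ rest) (TR : rest ⊑ R) (eb : V.tail b ≡ r ⊕ combo e R) where
    R' : Vec (V (suc f)) (suc d)
    R' = (true ∷ r) ∷ V.map (false ∷_) R
    R⊑ : ∀ t → InSpan R t → InSpan (b ∷ Bs) (false ∷ t)
    R⊑ t s = rest⊑ t (RT t s)
    b-split : b ≡ true ∷ (r ⊕ combo e R)
    b-split = head∷tail b hb eb
      where head∷tail : ∀ (z : V (suc f)) {w} → hd z ≡ true → V.tail z ≡ w → z ≡ true ∷ w
            head∷tail (z0 ∷ z) refl refl = refl
    newRows⊑ : ∀ i → InSpan (b ∷ Bs) (lookup R' i)
    newRows⊑ F.zero = subst (InSpan (b ∷ Bs)) eq (span-⊕ (b ∷ Bs) (span-gen (b ∷ Bs) F.zero) (R⊑ (combo e R) (e , refl)))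
      where
      eq : b ⊕ (false ∷ combo e R) ≡ true ∷ r
      eq = begin
          b ⊕ (false ∷ combo e R)    ≡⟨ cong (_⊕ (false ∷ combo e R)) b-split ⟩
          true ∷ ((r ⊕ combo e R) ⊕ combo e R) ≡⟨ cong (true ∷_) (⊕-assoc r _ _) ⟩
          true ∷ (r ⊕ (combo e R ⊕ combo e R)) ≡⟨ cong (λ z → true ∷ (r ⊕ z)) (⊕-self _) ⟩
          true ∷ (r ⊕ 0v)                      ≡⟨ cong (true ∷_) (⊕-identityʳ r) ⟩
          true ∷ r ∎
        where open ≡-Reasoning
    newRows⊑ (F.suc j) = subst (InSpan (b ∷ Bs)) (sym (VecP.lookup-map j (false ∷_) R)) (R⊑ (lookup R j) (span-gen R j))
    K : ∀ t → InSpan R t → InSpan R' (false ∷ t)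
    K t (g , refl) = false ∷ g , combo-0∷ g R
    pivotRow∈ : InSpan R' b
    pivotRow∈ = true ∷ e , trans (combo-pivot true e r R) (sym b-split)
    oldRows⊑ : ∀ i → InSpan R' (lookup (b ∷ Bs) i)
    oldRows⊑ F.zero = pivotRow∈
    oldRows⊑ (F.suc j) = subst (InSpan R') eq (span-⊕ R' (K _ (TR _ tail∈rest)) (span-· R' (hd x) pivotRow∈))
      where
      x : V (suc f)
      x = lookup Bs j
      tail∈rest : InSpan rest (V.tail (clear x))
      tail∈rest = subst (InSpan rest) (trans (VecP.lookup-map j V.tail cleared) (cong V.tail (VecP.lookup-map j clear Bs)))
             (span-gen rest j)
      hd-clear : hd (clear x) ≡ false
      hd-clear = trans (hd-⊕ x _) (trans (cong (hd x xor_) (hd-·pivot (hd x))) (BP.xor-same (hd x)))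
      eq : (false ∷ V.tail (clear x)) ⊕ (hd x · b) ≡ x
      eq = begin
          (false ∷ V.tail (clear x)) ⊕ (hd x · b)  ≡⟨ cong (_⊕ (hd x · b)) (sym (cong (_∷ V.tail (clear x)) hd-clear)) ⟩
          (hd (clear x) ∷ V.tail (clear x)) ⊕ (hd x · b) ≡⟨ cong (_⊕ (hd x · b)) (ht (clear x)) ⟩
          (x ⊕ (hd x · b)) ⊕ (hd x · b)          ≡⟨ ⊕-assoc x _ _ ⟩
          x ⊕ ((hd x · b) ⊕ (hd x · b))          ≡⟨ cong (x ⊕_) (⊕-self _) ⟩
          x ⊕ 0v                                  ≡⟨ ⊕-identityʳ x ⟩
          x ∎
        where open ≡-Reasoning
              ht : ∀ (z : V (suc f)) → (hd z ∷ V.tail z) ≡ z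
              ht (z0 ∷ z) = refl

  step : HasEchelons f → LinIndep (b ∷ Bs) →
    ∃[ p ] (p ∈ echelons (suc d) (suc f) × proj₁ p ⊑ (b ∷ Bs) × (b ∷ Bs) ⊑ proj₁ p)
  step ih ind with ih d rest (rest-independent ind)
  ... | (R , m) , p∈ , RT , TR with echelon-reduce p∈ (V.tail b)
  ... | r , r∈ , e , eb = pivot ((R , m) , r) ,
        ∈-++⁺ʳ (map nonPivot (echelons (suc d) f)) (∈-map⁺ pivot (pairsOver-∈⁺ p∈ r∈)) ,
        span-⊑ (NewBasis.R' R r e RT TR eb) (b ∷ Bs) (NewBasis.newRows⊑ R r e RT TR eb) ,
        span-⊑ (b ∷ Bs) (NewBasis.R' R r e RT TR eb) (NewBasis.oldRows⊑ R r e RT TR eb)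

zero-column : ∀ {f d} (B : Vec (V (suc f)) d) → (∀ c → hd (combo c B) ≡ false) →
  ∀ c → combo c B ≡ false ∷ combo c (tails B)
zero-column B hf c = trans (combo-split c B) (cong (_∷ combo c (tails B)) (hf c))

zeroColumnStep : ∀ {f d} → HasEchelons f → (B : Vec (V (suc f)) (suc d)) → LinIndep B →
  (∀ c → hd (combo c B) ≡ false) →
  ∃[ p ] (p ∈ echelons (suc d) (suc f) × proj₁ p ⊑ B × B ⊑ proj₁ p)
zeroColumnStep {f} {d} ih B ind hf
  with ih (suc d) (tails B) (λ c e → ind c (trans (zero-column B hf c) (cong (false ∷_) e)))
... | (R , m) , p∈ , RT , TR = nonPivot (R , m) , ∈-++⁺ˡ (∈-map⁺ nonPivot p∈) , R⊑B , B⊑R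
  where
  R⊑B : V.map (false ∷_) R ⊑ B
  R⊑B y (g , refl) with RT (combo g R) (g , refl)
  ... | c , e = c , trans (zero-column B hf c) (trans (cong (false ∷_) e) (sym (combo-0∷ g R)))
  B⊑R : B ⊑ V.map (false ∷_) R
  B⊑R y (c , refl) with TR (combo c (tails B)) (c , refl)
  ... | g , e = g , trans (combo-0∷ g R) (trans (cong (false ∷_) e) (sym (zero-column B hf c)))

row-operation : ∀ {v d} (b : V v) (Bs : Vec (V v) d) (cs : Vec Bool d) → LinIndep (b ∷ Bs) →
  LinIndep ((b ⊕ combo cs Bs) ∷ Bs) × ((b ⊕ combo cs Bs) ∷ Bs) ⊑ (b ∷ Bs) × (b ∷ Bs) ⊑ ((b ⊕ combo cs Bs) ∷ Bs)
row-operation {v} {d} b Bs cs ind = independent' , span-⊑ B' B new⊑old , span-⊑ B B' old⊑new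
  where
  B : Vec (V v) (suc d)
  B = b ∷ Bs
  B' : Vec (V v) (suc d)
  B' = (b ⊕ combo cs Bs) ∷ Bs
  independent' : LinIndep B'
  independent' (c0 ∷ c) e = coefficients c0 shifted≡0
    where
    coefficients : ∀ c0 → c0 ∷ ((c0 · cs) ⊕ c) ≡ false ∷ replicate d false → c0 ∷ c ≡ false ∷ replicate d false
    coefficients false h = cong (false ∷_) (trans (sym (⊕-identityˡ c)) (VecP.∷-injectiveʳ h))
    coefficients true ()
    eq : combo (c0 ∷ c) B' ≡ combo (c0 ∷ ((c0 · cs) ⊕ c)) B
    eq = begin
        combo (c0 ∷ c) B'                            ≡⟨ combo-∷ c0 c _ Bs ⟩
        (c0 · (b ⊕ combo cs Bs)) ⊕ combo c Bs        ≡⟨ cong (_⊕ combo c Bs) (·-⊕ c0 b _) ⟩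
        ((c0 · b) ⊕ (c0 · combo cs Bs)) ⊕ combo c Bs ≡⟨ ⊕-assoc _ _ _ ⟩
        (c0 · b) ⊕ ((c0 · combo cs Bs) ⊕ combo c Bs) ≡⟨ cong (λ k → (c0 · b) ⊕ (k ⊕ combo c Bs)) (sym (combo-· c0 cs Bs)) ⟩
        (c0 · b) ⊕ (combo (c0 · cs) Bs ⊕ combo c Bs) ≡⟨ cong ((c0 · b) ⊕_) (sym (combo-⊕ (c0 · cs) c Bs)) ⟩
        (c0 · b) ⊕ combo ((c0 · cs) ⊕ c) Bs          ≡⟨ sym (combo-∷ c0 ((c0 · cs) ⊕ c) b Bs) ⟩
        combo (c0 ∷ ((c0 · cs) ⊕ c)) B ∎
      where open ≡-Reasoning
    shifted≡0 : c0 ∷ ((c0 · cs) ⊕ c) ≡ false ∷ replicate d false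
    shifted≡0 = ind _ (trans (sym eq) e)
  combo∈ : InSpan B (combo cs Bs)
  combo∈ = false ∷ cs , refl
  new⊑old : ∀ i → InSpan B (lookup B' i)
  new⊑old F.zero = span-⊕ B (span-gen B F.zero) combo∈
  new⊑old (F.suc j) = span-gen B (F.suc j)
  old⊑new : ∀ i → InSpan B' (lookup B i)
  old⊑new F.zero = subst (InSpan B') eq (span-⊕ B' (span-gen B' F.zero) (false ∷ cs , refl))
    where eq : (b ⊕ combo cs Bs) ⊕ combo cs Bs ≡ b
          eq = trans (⊕-assoc b _ _) (trans (cong (b ⊕_) (⊕-self _)) (⊕-identityʳ b))
  old⊑new (F.suc j) = span-gen B' (F.suc j)

echelon-exists : ∀ f → HasEchelons f
echelon-exists f zero [] ind = ([] , replicate f false) , here refl , (λ y s → s) , (λ y s → s)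
echelon-exists zero (suc d) ([] ∷ Bs) ind with ind (true ∷ replicate d false) (V0-zero _)
  where V0-zero : ∀ (z : V 0) → z ≡ 0v
        V0-zero [] = refl
... | ()
echelon-exists (suc f) (suc d) (b ∷ Bs) ind with hd b in hb
... | true = PivotStep.step b hb Bs (echelon-exists f) ind
... | false with Any.any? (λ cs → hd (combo cs Bs) B.≟ true) (allVecs d)
... | yes a with Any.satisfied a
... | cs , hc with row-operation b Bs cs ind
... | ind' , s1 , s2 with PivotStep.step (b ⊕ combo cs Bs) (trans (hd-⊕ b _) (trans (cong (_xor hd (combo cs Bs)) hb) hc)) Bs (echelon-exists f) ind'
... | p , p∈ , t1 , t2 = p , p∈ , (λ y s → s1 y (t1 y s)) , (λ y s → t2 y (s2 y s))
echelon-exists (suc f) (suc d) (b ∷ Bs) ind | false | no na =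
  zeroColumnStep (echelon-exists f) (b ∷ Bs) ind hf
  where
  hf : ∀ c → hd (combo c (b ∷ Bs)) ≡ false
  hf (c0 ∷ cs) = trans (cong hd (combo-∷ c0 cs b Bs)) (trans (hd-⊕ (c0 · b) _)
    (cong₂ _xor_ (trans (hd-· c0 b) (trans (cong (c0 ∧_) hb) (BP.∧-zeroʳ c0))) hcs))
    where
    hcs : hd (combo cs Bs) ≡ false
    hcs with hd (combo cs Bs) in e
    ... | false = refl
    ... | true = ⊥-elim (na (Any.map (λ { refl → e }) (allVecs-∈ cs)))

map∷-inj : ∀ {f d} (b : Bool) (R S : Vec (V f) d) → V.map (b ∷_) R ≡ V.map (b ∷_) S → R ≡ S
map∷-inj b [] [] e = refl
map∷-inj b (x ∷ R) (y ∷ S) e = cong₂ _∷_ (VecP.∷-injectiveʳ (VecP.∷-injectiveˡ e)) (map∷-inj b R S (VecP.∷-injectiveʳ e))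

reduced-unique : ∀ {f} (m : Vec Bool f) → Unique (reduced m)
reduced-unique [] = [] ∷ []
reduced-unique (true ∷ m) = map⁺ ∷-injʳ (reduced-unique m)
reduced-unique (false ∷ m) = ++⁺ (map⁺ ∷-injʳ (reduced-unique m))
  (map⁺ ∷-injʳ (reduced-unique m))
  (disjoint-images (false ∷_) (true ∷_) λ ())

echelons-unique : ∀ d f → Unique (echelons d f)
echelons-unique zero f = [] ∷ []
echelons-unique (suc d) zero = []
echelons-unique (suc d) (suc f) =
  ++⁺ (map⁺ injA (echelons-unique (suc d) f)) (map⁺ injB (pairsOver-unique (echelons-unique d f) (λ p → reduced-unique (proj₂ p))))
    (disjoint-images nonPivot pivot nonPivot≢pivot)
  where
  injA : ∀ {p q : Echelon (suc d) f} → nonPivot p ≡ nonPivot q → p ≡ q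
  injA {R , m} {S , m'} e = cong₂ _,_ (map∷-inj false R S (cong proj₁ e)) (VecP.∷-injectiveʳ (cong proj₂ e))
  injB : ∀ {p q : Echelon d f × V f} → pivot p ≡ pivot q → p ≡ q
  injB {(T , m) , r} {(S , m') , r'} e =
    cong₂ _,_ (cong₂ _,_ (map∷-inj false T S (VecP.∷-injectiveʳ (cong proj₁ e))) (VecP.∷-injectiveʳ (cong proj₂ e)))
      (VecP.∷-injectiveʳ (VecP.∷-injectiveˡ (cong proj₁ e)))

nonPivots : ∀ {f} → Vec Bool f → ℕ
nonPivots [] = 0
nonPivots (true ∷ m) = nonPivots m
nonPivots (false ∷ m) = suc (nonPivots m)

length-reduced : ∀ {f} (m : Vec Bool f) → length (reduced m) ≡ 2 ^ nonPivots m
length-reduced [] = refl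
length-reduced (true ∷ m) = trans (LP.length-map _ (reduced m)) (length-reduced m)
length-reduced (false ∷ m) = begin
    length (map (false ∷_) (reduced m) L.++ map (true ∷_) (reduced m))  ≡⟨ LP.length-++ (map (false ∷_) (reduced m)) ⟩
    length (map (false ∷_) (reduced m)) + length (map (true ∷_) (reduced m))
      ≡⟨ cong₂ _+_ (trans (LP.length-map _ (reduced m)) (length-reduced m)) (trans (LP.length-map _ (reduced m)) (length-reduced m)) ⟩
    2 ^ nonPivots m + 2 ^ nonPivots m  ≡⟨ cong (2 ^ nonPivots m +_) (sym (NP.+-identityʳ _)) ⟩
    2 ^ suc (nonPivots m) ∎
  where open ≡-Reasoning

echelon-nonPivots : ∀ {d f} {p : Echelon d f} → p ∈ echelons d f → nonPivots (proj₂ p) + d ≡ f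
echelon-nonPivots {zero} {f} (here refl) = trans (NP.+-identityʳ _) (allNonPivots f)
  where allNonPivots : ∀ f → nonPivots (replicate f false) ≡ f
        allNonPivots zero = refl
        allNonPivots (suc f) = cong suc (allNonPivots f)
echelon-nonPivots {suc d} {zero} ()
echelon-nonPivots {suc d} {suc f} h with echelons-∈⁻ h
... | inj₁ ((R , m) , p∈ , refl) = cong suc (echelon-nonPivots p∈)
... | inj₂ ((T , m) , r , p∈ , r∈ , refl) = trans (NP.+-suc (nonPivots m) d) (cong suc (echelon-nonPivots p∈))

-- the number of d-dimensional subspaces of F₂^f
gauss : ℕ → ℕ → ℕ
gauss d f = length (echelons d f)

gauss-rec : ∀ d f → gauss (suc d) (suc f) ≡ gauss (suc d) f + gauss d f * 2 ^ (f ∸ d)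
gauss-rec d f = begin
    length (map nonPivot (echelons (suc d) f) L.++ map pivot (pairsOver (echelons d f) (λ p → reduced (proj₂ p))))
      ≡⟨ LP.length-++ (map nonPivot (echelons (suc d) f)) ⟩
    length (map nonPivot (echelons (suc d) f)) + length (map pivot (pairsOver (echelons d f) (λ p → reduced (proj₂ p))))
      ≡⟨ cong₂ _+_ (LP.length-map nonPivot (echelons (suc d) f)) (LP.length-map pivot (pairsOver (echelons d f) (λ p → reduced (proj₂ p)))) ⟩
    gauss (suc d) f + length (pairsOver (echelons d f) (λ p → reduced (proj₂ p)))
      ≡⟨ cong (gauss (suc d) f +_) (pairsOver-length (echelons d f) _ (2 ^ (f ∸ d))
           (λ p p∈ → trans (length-reduced (proj₂ p)) (cong (2 ^_) (sym (trans (cong (_∸ d) (sym (echelon-nonPivots p∈))) (NP.m+n∸n≡m _ d)))))) ⟩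
    gauss (suc d) f + gauss d f * 2 ^ (f ∸ d) ∎
  where open ≡-Reasoning

-- 2^f ∸ 1, given recursively so that identities are ring identities
mersenne : ℕ → ℕ
mersenne zero = 0
mersenne (suc f) = suc (2 * mersenne f)

2^≡1+mersenne : ∀ f → 2 ^ f ≡ suc (mersenne f)
2^≡1+mersenne zero = refl
2^≡1+mersenne (suc f) = trans (cong (2 *_) (2^≡1+mersenne f)) (ring (mersenne f))
  where ring : ∀ x → 2 * suc x ≡ suc (suc (2 * x))
        ring = solve-∀

mersenne≡2^∸1 : ∀ f → 2 ^ f ∸ 1 ≡ mersenne f
mersenne≡2^∸1 f = cong (_∸ 1) (2^≡1+mersenne f)

gauss-1 : ∀ f → gauss 1 f ≡ mersenne f
gauss-1 zero = refl
gauss-1 (suc f) = trans (gauss-rec 0 f) (trans (cong₂ _+_ (gauss-1 f) (NP.*-identityˡ _)) (trans (cong (mersenne f +_) (2^≡1+mersenne f)) (ring (mersenne f))))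
  where ring : ∀ x → x + suc x ≡ suc (2 * x)
        ring = solve-∀

gauss-2 : ∀ g → gauss 2 (suc g) * 3 ≡ mersenne (suc g) * mersenne g
gauss-2 zero = refl
gauss-2 (suc g) = begin
    gauss 2 (suc (suc g)) * 3 ≡⟨ cong (_* 3) (gauss-rec 1 (suc g)) ⟩
    (gauss 2 (suc g) + gauss 1 (suc g) * 2 ^ g) * 3 ≡⟨ NP.*-distribʳ-+ 3 (gauss 2 (suc g)) _ ⟩
    gauss 2 (suc g) * 3 + gauss 1 (suc g) * 2 ^ g * 3 ≡⟨ cong₂ _+_ (gauss-2 g) (cong₂ (λ a b → a * b * 3) (gauss-1 (suc g)) (2^≡1+mersenne g)) ⟩
    mersenne (suc g) * mersenne g + mersenne (suc g) * suc (mersenne g) * 3 ≡⟨ ring (mersenne g) ⟩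
    mersenne (suc (suc g)) * mersenne (suc g) ∎
  where open ≡-Reasoning
        ring : ∀ x → suc (2 * x) * x + suc (2 * x) * suc x * 3 ≡ suc (2 * suc (2 * x)) * suc (2 * x)
        ring = solve-∀

gauss-3 : ∀ g → gauss 3 (suc (suc g)) * 21 ≡ mersenne (suc (suc g)) * mersenne (suc g) * mersenne g
gauss-3 zero = refl
gauss-3 (suc g) = begin
    gauss 3 (suc (suc (suc g))) * 21 ≡⟨ cong (_* 21) (gauss-rec 2 (suc (suc g))) ⟩
    (gauss 3 (suc (suc g)) + gauss 2 (suc (suc g)) * 2 ^ g) * 21 ≡⟨ NP.*-distribʳ-+ 21 (gauss 3 (suc (suc g))) _ ⟩
    gauss 3 (suc (suc g)) * 21 + gauss 2 (suc (suc g)) * 2 ^ g * 21 ≡⟨ cong₂ _+_ (gauss-3 g) (regroup (gauss 2 (suc (suc g))) (2 ^ g)) ⟩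
    mersenne (suc (suc g)) * mersenne (suc g) * mersenne g + (gauss 2 (suc (suc g)) * 3) * 2 ^ g * 7
      ≡⟨ cong₂ (λ a b → mersenne (suc (suc g)) * mersenne (suc g) * mersenne g + a * b * 7) (gauss-2 (suc g)) (2^≡1+mersenne g) ⟩
    mersenne (suc (suc g)) * mersenne (suc g) * mersenne g + (mersenne (suc (suc g)) * mersenne (suc g)) * suc (mersenne g) * 7 ≡⟨ ring (mersenne g) ⟩
    mersenne (suc (suc (suc g))) * mersenne (suc (suc g)) * mersenne (suc g) ∎
  where open ≡-Reasoning
        regroup : ∀ a b → a * b * 21 ≡ (a * 3) * b * 7
        regroup = solve-∀
        ring : ∀ x → suc (2 * suc (2 * x)) * suc (2 * x) * x + (suc (2 * suc (2 * x)) * suc (2 * x)) * suc x * 7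
                  ≡ suc (2 * suc (2 * suc (2 * x))) * suc (2 * suc (2 * x)) * suc (2 * x)
        ring = solve-∀

gauss-3-closed : ∀ f → gauss 3 f * 21 ≡ (2 ^ f ∸ 1) * (2 ^ (f ∸ 1) ∸ 1) * (2 ^ (f ∸ 2) ∸ 1)
gauss-3-closed zero = refl
gauss-3-closed (suc zero) = refl
gauss-3-closed (suc (suc g)) = trans (gauss-3 g) (sym (cong₂ _*_ (cong₂ _*_ (mersenne≡2^∸1 (suc (suc g))) (mersenne≡2^∸1 (suc g))) (mersenne≡2^∸1 g)))

too-many-dependent : ∀ {d f} (C : Vec (V f) d) → f < d → ¬ LinIndep C
too-many-dependent {d} {f} C f<d ind with echelon-exists f d C ind
... | p , p∈ , _ = NP.<-irrefl refl (NP.<-≤-trans f<d (subst (d ≤_) (echelon-nonPivots p∈) (NP.m≤n+m d _)))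

span-dimension-bound : ∀ {n k m} (B : Vec (V n) k) (Y : Vec (V n) m) → k < m →
  (∀ i → InSpan B (lookup Y i)) → ¬ LinIndep Y
span-dimension-bound {n} {k} {m} B Y k<m h ind = too-many-dependent C k<m indC
  where
  C : Vec (V k) m
  C = V.tabulate (λ i → proj₁ (h i))
  YC : Y ≡ V.map (λ c → combo c B) C
  YC = trans (sym (VecP.tabulate∘lookup Y)) (trans (VecP.tabulate-cong (λ i → sym (proj₂ (h i))))
        (VecP.tabulate-∘ (λ c → combo c B) (λ i → proj₁ (h i))))
  indC : LinIndep C
  indC d e = ind d (begin
      combo d Y                                ≡⟨ cong (combo d) YC ⟩
      combo d (V.map (λ c → combo c B) C)      ≡⟨ combo-combo d C B ⟩
      combo (combo d C) B                      ≡⟨ cong (λ z → combo z B) e ⟩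
      combo 0v B                               ≡⟨ combo-zeroˡ B ⟩
      0v ∎)
    where open ≡-Reasoning

rot-⊕ : ∀ q (x y : V (q * 2)) → rot q (x ⊕ y) ≡ rot q x ⊕ rot q y
rot-⊕ zero    []          []          = refl
rot-⊕ (suc q) (a ∷ b ∷ x) (c ∷ d ∷ y) =
  cong₂ _∷_ refl (cong₂ _∷_ (xor-interchange a c b d) (rot-⊕ q x y))

rot-0 : ∀ q → rot q 0v ≡ 0v
rot-0 zero    = refl
rot-0 (suc q) = cong (λ z → false ∷ false ∷ z) (rot-0 q)

rot³ : ∀ q (u : V (q * 2)) → rot q (rot q (rot q u)) ≡ u
rot³ zero    []          = refl
rot³ (suc q) (a ∷ b ∷ u) = cong₂ _∷_ (first a b) (cong₂ _∷_ (second a b) (rot³ q u))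
  where
  first : ∀ a b → b xor (a xor b) ≡ a
  first false false = refl
  first false true  = refl
  first true  false = refl
  first true  true  = refl
  second : ∀ a b → (a xor b) xor (b xor (a xor b)) ≡ b
  second false false = refl
  second false true  = refl
  second true  false = refl
  second true  true  = refl

rot-sum : ∀ q (u : V (q * 2)) → u ⊕ rot q u ≡ rot q (rot q u)
rot-sum zero    []          = refl
rot-sum (suc q) (a ∷ b ∷ u) = cong (λ z → (a xor b) ∷ (b xor (a xor b)) ∷ z) (rot-sum q u)

rot-fixed : ∀ q (u : V (q * 2)) → rot q u ≡ u → u ≡ 0v
rot-fixed zero    []          e = refl
rot-fixed (suc q) (a ∷ b ∷ u) e with VecP.∷-injective e
... | e₁ , e₂ with VecP.∷-injective e₂
... | e₃ , e₄ = cong₂ _∷_ (fst a b e₁ e₃) (cong₂ _∷_ (snd a b e₁ e₃) (rot-fixed q u e₄))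
  where
  fst : ∀ a b → b ≡ a → (a xor b) ≡ b → a ≡ false
  fst false b     _  _  = refl
  fst true  false () _
  fst true  true  _  ()
  snd : ∀ a b → b ≡ a → (a xor b) ≡ b → b ≡ false
  snd a     false _  _  = refl
  snd false true  () _
  snd true  true  _  ()

module Rotation (q : ℕ) where
  ρ : V (q * 2) → V (q * 2)
  ρ = rot q

  ρ² : V (q * 2) → V (q * 2)
  ρ² u = ρ (ρ u)

  ρ-injective : ∀ {x y} → ρ x ≡ ρ y → x ≡ y
  ρ-injective {x} {y} e = trans (sym (rot³ q x)) (trans (cong ρ² e) (rot³ q y))

  ρ≡0 : ∀ {u} → ρ u ≡ 0v → u ≡ 0v
  ρ≡0 e = ρ-injective (trans e (sym (rot-0 q)))

  ρ²≡0 : ∀ {u} → ρ² u ≡ 0v → u ≡ 0v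
  ρ²≡0 e = ρ≡0 (ρ≡0 e)

  ρ-moves : ∀ {u} → u ≢ 0v → ρ u ≢ u
  ρ-moves nz e = nz (rot-fixed q _ e)

  ρ²-moves : ∀ {u} → u ≢ 0v → ρ² u ≢ u
  ρ²-moves {u} nz e = nz (rot-fixed q u (sym (trans (sym (rot³ q u)) (cong ρ e))))

  ρ²≢ρ : ∀ {u} → u ≢ 0v → ρ² u ≢ ρ u
  ρ²≢ρ {u} nz e = nz (ρ≡0 (rot-fixed q (ρ u) e))

  InOrbit : V (q * 2) → V (q * 2) → Set
  InOrbit u x = x ≡ u ⊎ x ≡ ρ u ⊎ x ≡ ρ² u

  InOrbit? : ∀ u x → Dec (InOrbit u x)
  InOrbit? u x = (x ≟ᵛ u) ⊎-dec ((x ≟ᵛ ρ u) ⊎-dec (x ≟ᵛ ρ² u))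

  InOrbit-ρ : ∀ {u x} → InOrbit u x → InOrbit u (ρ x)
  InOrbit-ρ     (inj₁ refl)        = inj₂ (inj₁ refl)
  InOrbit-ρ     (inj₂ (inj₁ refl)) = inj₂ (inj₂ refl)
  InOrbit-ρ {u} (inj₂ (inj₂ refl)) = inj₁ (rot³ q u)

  InOrbit-sym : ∀ {u x} → InOrbit u x → InOrbit x u
  InOrbit-sym     (inj₁ refl)        = inj₁ refl
  InOrbit-sym {u} (inj₂ (inj₁ refl)) = inj₂ (inj₂ (sym (rot³ q u)))
  InOrbit-sym {u} (inj₂ (inj₂ refl)) = inj₂ (inj₁ (sym (rot³ q u)))

  InOrbit-trans : ∀ {u x y} → InOrbit u x → InOrbit x y → InOrbit u y
  InOrbit-trans ox (inj₁ refl)        = ox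
  InOrbit-trans ox (inj₂ (inj₁ refl)) = InOrbit-ρ ox
  InOrbit-trans ox (inj₂ (inj₂ refl)) = InOrbit-ρ (InOrbit-ρ ox)

  ρ^ : ℕ → V (q * 2) → V (q * 2)
  ρ^ zero    u = u
  ρ^ (suc n) u = ρ (ρ^ n u)

  ρ^-InOrbit : ∀ n u → InOrbit u (ρ^ n u)
  ρ^-InOrbit zero    u = inj₁ refl
  ρ^-InOrbit (suc n) u = InOrbit-ρ (ρ^-InOrbit n u)

  InOrbit-ρ^ : ∀ {u x} → InOrbit u x → ∃[ n ] ρ^ n u ≡ x
  InOrbit-ρ^ (inj₁ refl)        = 0 , refl
  InOrbit-ρ^ (inj₂ (inj₁ refl)) = 1 , refl
  InOrbit-ρ^ (inj₂ (inj₂ refl)) = 2 , refl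

  ρ^-0 : ∀ n → ρ^ n 0v ≡ 0v
  ρ^-0 zero    = refl
  ρ^-0 (suc n) = trans (cong ρ (ρ^-0 n)) (rot-0 q)

  ρ^-+ : ∀ m n u → ρ^ (m + n) u ≡ ρ^ m (ρ^ n u)
  ρ^-+ zero    n u = refl
  ρ^-+ (suc m) n u = cong ρ (ρ^-+ m n u)

  ρ^-3 : ∀ n u → ρ^ (n * 3) u ≡ u
  ρ^-3 zero    u = refl
  ρ^-3 (suc n) u = trans (cong (λ z → ρ (ρ (ρ z))) (ρ^-3 n u)) (rot³ q u)

  ρ^-inverse : ∀ n u → ρ^ n (ρ^ (n * 2) u) ≡ u
  ρ^-inverse n u = trans (sym (ρ^-+ n (n * 2) u)) (trans (cong (λ k → ρ^ k u) (sym (NP.*-suc n 2))) (ρ^-3 n u))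

  -- x lies on the orbit line of u, the line {0, u, ρu, ρ²u} = span{u, ρu}
  OnOrbitLine : V (q * 2) → V (q * 2) → Set
  OnOrbitLine u x = x ≡ 0v ⊎ InOrbit u x

  OnOrbitLine? : ∀ u x → Dec (OnOrbitLine u x)
  OnOrbitLine? u x = (x ≟ᵛ 0v) ⊎-dec InOrbit? u x

  InOrbit-0 : ∀ {y} → InOrbit 0v y → y ≡ 0v
  InOrbit-0 (inj₁ e)        = e
  InOrbit-0 (inj₂ (inj₁ e)) = trans e (rot-0 q)
  InOrbit-0 (inj₂ (inj₂ e)) = trans e (trans (cong ρ (rot-0 q)) (rot-0 q))

  OnOrbitLine-InOrbit : ∀ {u x y} → OnOrbitLine u x → InOrbit x y → OnOrbitLine u y
  OnOrbitLine-InOrbit (inj₁ refl) o = inj₁ (InOrbit-0 o)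
  OnOrbitLine-InOrbit (inj₂ ox)   o = inj₂ (InOrbit-trans ox o)

  OnOrbitLine-ρ^ : ∀ {u x} n → OnOrbitLine u x → OnOrbitLine u (ρ^ n x)
  OnOrbitLine-ρ^ n o = OnOrbitLine-InOrbit o (ρ^-InOrbit n _)

  OnOrbitLine-change : ∀ {a u x} → InOrbit a u → OnOrbitLine a x → OnOrbitLine u x
  OnOrbitLine-change au (inj₁ e)  = inj₁ e
  OnOrbitLine-change au (inj₂ ax) = inj₂ (InOrbit-trans (InOrbit-sym au) ax)

  lineCombo : Bool → Bool → V (q * 2) → V (q * 2)
  lineCombo c₁ c₂ a = (c₁ · a) ⊕ (c₂ · ρ a)

  lineCombo-OnOrbitLine : ∀ c₁ c₂ a → OnOrbitLine a (lineCombo c₁ c₂ a)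
  lineCombo-OnOrbitLine false false a = inj₁ (⊕-identityˡ 0v)
  lineCombo-OnOrbitLine true  false a = inj₂ (inj₁ (⊕-identityʳ a))
  lineCombo-OnOrbitLine false true  a = inj₂ (inj₂ (inj₁ (⊕-identityˡ _)))
  lineCombo-OnOrbitLine true  true  a = inj₂ (inj₂ (inj₂ (rot-sum q a)))

  OnOrbitLine-lineCombo : ∀ {a t} → OnOrbitLine a t → ∃[ c₁ ] ∃[ c₂ ] lineCombo c₁ c₂ a ≡ t
  OnOrbitLine-lineCombo     (inj₁ refl)               = false , false , ⊕-identityˡ 0v
  OnOrbitLine-lineCombo {a} (inj₂ (inj₁ refl))        = true  , false , ⊕-identityʳ a
  OnOrbitLine-lineCombo     (inj₂ (inj₂ (inj₁ refl))) = false , true  , ⊕-identityˡ _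
  OnOrbitLine-lineCombo {a} (inj₂ (inj₂ (inj₂ refl))) = true  , true  , rot-sum q a

  lineCombo≡0 : ∀ {a} c₁ c₂ → a ≢ 0v → lineCombo c₁ c₂ a ≡ 0v → (c₁ ≡ false) × (c₂ ≡ false)
  lineCombo≡0     false false nz e = refl , refl
  lineCombo≡0 {a} true  false nz e = ⊥-elim (nz (trans (sym (⊕-identityʳ a)) e))
  lineCombo≡0 {a} false true  nz e = ⊥-elim (nz (ρ≡0 (trans (sym (⊕-identityˡ _)) e)))
  lineCombo≡0 {a} true  true  nz e = ⊥-elim (nz (ρ²≡0 (trans (sym (rot-sum q a)) e)))

  lineCombo-InOrbit : ∀ {a} c₁ c₂ → ¬ ((c₁ ≡ false) × (c₂ ≡ false)) → InOrbit a (lineCombo c₁ c₂ a)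
  lineCombo-InOrbit     false false n = ⊥-elim (n (refl , refl))
  lineCombo-InOrbit {a} true  false n = inj₁ (⊕-identityʳ a)
  lineCombo-InOrbit     false true  n = inj₂ (inj₁ (⊕-identityˡ _))
  lineCombo-InOrbit {a} true  true  n = inj₂ (inj₂ (rot-sum q a))




-- One representative of every nonzero ⟨ρ⟩-orbit: the vectors whose first
-- nonzero coordinate pair is (1, 0).  There are (2^(2q) ∸ 1)/3 of them.
orbitReps : ∀ q → List (V (q * 2))
orbitReps zero = []
orbitReps (suc q) = map (λ u → true ∷ false ∷ u) (allVecs (q * 2)) L.++ map (λ u → false ∷ false ∷ u) (orbitReps q)

orbitReps-∈⁻ : ∀ q {u : V (suc q * 2)} → u ∈ orbitReps (suc q) →
  (∃[ x ] u ≡ true ∷ false ∷ x) ⊎ (∃[ x ] (x ∈ orbitReps q × u ≡ false ∷ false ∷ x))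
orbitReps-∈⁻ q h with ∈-++⁻ (map (λ u → true ∷ false ∷ u) (allVecs (q * 2))) h
... | inj₁ h' with ∈-map⁻ _ h'
... | x , _ , e = inj₁ (x , e)
orbitReps-∈⁻ q h | inj₂ h' with ∈-map⁻ _ h'
... | x , x∈ , e = inj₂ (x , x∈ , e)

orbitReps-nonzero : ∀ q {u} → u ∈ orbitReps q → u ≢ 0v
orbitReps-nonzero zero ()
orbitReps-nonzero (suc q) h e with orbitReps-∈⁻ q h
... | inj₁ (x , refl) = case e of λ ()
... | inj₂ (x , x∈ , refl) = orbitReps-nonzero q x∈ (∷-injʳ (∷-injʳ e))

orbitReps-ρ : ∀ q {u} → u ∈ orbitReps q → rot q u ∈ orbitReps q → ⊥
orbitReps-ρ zero ()
orbitReps-ρ (suc q) h h' with orbitReps-∈⁻ q h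
... | inj₁ (x , refl) with orbitReps-∈⁻ q h'
... | inj₁ (y , ())
... | inj₂ (y , _ , ())
orbitReps-ρ (suc q) h h' | inj₂ (x , x∈ , refl) with orbitReps-∈⁻ q h'
... | inj₁ (y , ())
... | inj₂ (y , y∈ , e) = orbitReps-ρ q x∈ (subst (_∈ orbitReps q) (sym (∷-injʳ (∷-injʳ e))) y∈)

orbitReps-ρ² : ∀ q {u} → u ∈ orbitReps q → rot q (rot q u) ∈ orbitReps q → ⊥
orbitReps-ρ² zero ()
orbitReps-ρ² (suc q) h h' with orbitReps-∈⁻ q h
... | inj₁ (x , refl) with orbitReps-∈⁻ q h'
... | inj₁ (y , ())
... | inj₂ (y , _ , ())
orbitReps-ρ² (suc q) h h' | inj₂ (x , x∈ , refl) with orbitReps-∈⁻ q h'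
... | inj₁ (y , ())
... | inj₂ (y , y∈ , e) = orbitReps-ρ² q x∈ (subst (_∈ orbitReps q) (sym (∷-injʳ (∷-injʳ e))) y∈)

orbitReps-distinct : ∀ q {u u'} → u ∈ orbitReps q → u' ∈ orbitReps q → Rotation.InOrbit q u u' → u' ≡ u
orbitReps-distinct q h h' (inj₁ e) = e
orbitReps-distinct q h h' (inj₂ (inj₁ refl)) = ⊥-elim (orbitReps-ρ q h h')
orbitReps-distinct q h h' (inj₂ (inj₂ refl)) = ⊥-elim (orbitReps-ρ² q h h')

InOrbit-lift : ∀ q {x x'} → Rotation.InOrbit q x x' → Rotation.InOrbit (suc q) (false ∷ false ∷ x) (false ∷ false ∷ x')
InOrbit-lift q (inj₁ refl) = inj₁ refl
InOrbit-lift q (inj₂ (inj₁ refl)) = inj₂ (inj₁ refl)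
InOrbit-lift q (inj₂ (inj₂ refl)) = inj₂ (inj₂ refl)

orbitReps-complete : ∀ q (u : V (q * 2)) → u ≢ 0v → ∃[ u' ] (u' ∈ orbitReps q × Rotation.InOrbit q u u')
orbitReps-complete zero [] nz = ⊥-elim (nz refl)
orbitReps-complete (suc q) (false ∷ false ∷ x) nz with orbitReps-complete q x (λ e → nz (cong (λ z → false ∷ false ∷ z) e))
... | x' , x∈ , o = false ∷ false ∷ x' , ∈-++⁺ʳ (map (λ u → true ∷ false ∷ u) (allVecs (q * 2))) (∈-map⁺ _ x∈) , InOrbit-lift q o
orbitReps-complete (suc q) (true ∷ false ∷ x) nz = _ , ∈-++⁺ˡ (∈-map⁺ (λ u → true ∷ false ∷ u) (allVecs-∈ x)) , inj₁ refl
orbitReps-complete (suc q) (false ∷ true ∷ x) nz = _ , ∈-++⁺ˡ (∈-map⁺ (λ u → true ∷ false ∷ u) (allVecs-∈ (rot q (rot q x)))) , inj₂ (inj₂ refl)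
orbitReps-complete (suc q) (true ∷ true ∷ x) nz = _ , ∈-++⁺ˡ (∈-map⁺ (λ u → true ∷ false ∷ u) (allVecs-∈ (rot q x))) , inj₂ (inj₁ refl)

orbitReps-unique : ∀ q → Unique (orbitReps q)
orbitReps-unique zero = []
orbitReps-unique (suc q) = ++⁺ (map⁺ (λ e → ∷-injʳ (∷-injʳ e)) (allVecs-unique (q * 2)))
  (map⁺ (λ e → ∷-injʳ (∷-injʳ e)) (orbitReps-unique q))
  (disjoint-images _ _ λ ())

orbitReps-length : ∀ q → length (orbitReps q) * 3 ≡ mersenne (q * 2)
orbitReps-length zero = refl
orbitReps-length (suc q) = begin
    length (map (λ u → true ∷ false ∷ u) (allVecs (q * 2)) L.++ map (λ u → false ∷ false ∷ u) (orbitReps q)) * 3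
      ≡⟨ cong (_* 3) (LP.length-++ (map (λ u → true ∷ false ∷ u) (allVecs (q * 2)))) ⟩
    (length (map (λ u → true ∷ false ∷ u) (allVecs (q * 2))) + length (map (λ u → false ∷ false ∷ u) (orbitReps q))) * 3
      ≡⟨ cong (_* 3) (cong₂ _+_ (trans (LP.length-map _ (allVecs (q * 2))) (length-allVecs (q * 2))) (LP.length-map _ (orbitReps q))) ⟩
    (2 ^ (q * 2) + length (orbitReps q)) * 3  ≡⟨ NP.*-distribʳ-+ 3 (2 ^ (q * 2)) _ ⟩
    2 ^ (q * 2) * 3 + length (orbitReps q) * 3  ≡⟨ cong₂ (λ a b → a * 3 + b) (2^≡1+mersenne (q * 2)) (orbitReps-length q) ⟩
    suc (mersenne (q * 2)) * 3 + mersenne (q * 2) ≡⟨ ring (mersenne (q * 2)) ⟩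
    mersenne (suc (suc (q * 2))) ∎
  where open ≡-Reasoning
        ring : ∀ x → suc x * 3 + x ≡ suc (2 * suc (2 * x))
        ring = solve-∀

nonzeros : ∀ f → List (V f)
nonzeros zero = []
nonzeros (suc f) = map (true ∷_) (allVecs f) L.++ map (false ∷_) (nonzeros f)

nonzeros-∈⁻ : ∀ {f} {x : V f} → x ∈ nonzeros f → x ≢ 0v
nonzeros-∈⁻ {zero} ()
nonzeros-∈⁻ {suc f} h e with ∈-++⁻ (map (true ∷_) (allVecs f)) h
... | inj₁ h' with ∈-map⁻ _ h'
... | _ , _ , refl = case e of λ ()
nonzeros-∈⁻ {suc f} h e | inj₂ h' with ∈-map⁻ _ h'
... | y , y∈ , refl = nonzeros-∈⁻ y∈ (∷-injʳ e)

nonzeros-∈⁺ : ∀ {f} (x : V f) → x ≢ 0v → x ∈ nonzeros f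
nonzeros-∈⁺ [] nz = ⊥-elim (nz refl)
nonzeros-∈⁺ {suc f} (true ∷ x) nz = ∈-++⁺ˡ (∈-map⁺ _ (allVecs-∈ x))
nonzeros-∈⁺ {suc f} (false ∷ x) nz = ∈-++⁺ʳ (map (true ∷_) (allVecs f)) (∈-map⁺ _ (nonzeros-∈⁺ x (λ e → nz (cong (false ∷_) e))))

nonzeros-unique : ∀ f → Unique (nonzeros f)
nonzeros-unique zero = []
nonzeros-unique (suc f) = ++⁺ (map⁺ ∷-injʳ (allVecs-unique f))
  (map⁺ ∷-injʳ (nonzeros-unique f))
  (disjoint-images _ _ λ ())

nonzeros-length : ∀ f → length (nonzeros f) ≡ mersenne f
nonzeros-length zero = refl
nonzeros-length (suc f) = begin
    length (map (true ∷_) (allVecs f) L.++ map (false ∷_) (nonzeros f)) ≡⟨ LP.length-++ (map (true ∷_) (allVecs f)) ⟩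
    length (map (true ∷_) (allVecs f)) + length (map (false ∷_) (nonzeros f))
      ≡⟨ cong₂ _+_ (trans (LP.length-map _ (allVecs f)) (length-allVecs f)) (trans (LP.length-map _ (nonzeros f)) (nonzeros-length f)) ⟩
    2 ^ f + mersenne f ≡⟨ cong (_+ mersenne f) (2^≡1+mersenne f) ⟩
    suc (mersenne f) + mersenne f ≡⟨ ring (mersenne f) ⟩
    suc (2 * mersenne f) ∎
  where open ≡-Reasoning
        ring : ∀ x → suc x + x ≡ suc (2 * x)
        ring = solve-∀


find-or-all : ∀ {A : Set} {P : A → Set} → Decidable P → ∀ xs →
  (∃[ x ] (x ∈ xs × ¬ P x)) ⊎ (∀ x → x ∈ xs → P x)
find-or-all P? [] = inj₂ (λ x ())
find-or-all P? (y ∷ ys) with P? y | find-or-all P? ys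
... | no ¬py | _                    = inj₁ (y , here refl , ¬py)
... | yes _  | inj₁ (x , x∈ , ¬px) = inj₁ (x , there x∈ , ¬px)
... | yes py | inj₂ all            = inj₂ (λ { x (here refl) → py ; x (there x∈) → all x x∈ })

unique-same-length : ∀ {A : Set} {xs ys : List A} → Unique xs → Unique ys →
  (∀ {z} → (z ∈ xs) ⇔ (z ∈ ys)) → length xs ≡ length ys
unique-same-length uxs uys same = ↭-length (∼bag⇒↭ (unique∧set⇒bag uxs uys same))

extend-independent : ∀ {v d} {B : Vec (V v) d} {y : V v} → LinIndep B → ¬ InSpan B y → LinIndep (y ∷ B)
extend-independent ind y∉ (false ∷ c) e = cong (false ∷_) (ind c e)
extend-independent ind y∉ (true ∷ c)  e = ⊥-elim (y∉ (c , sym (⊕≡0⇒≡ _ _ e)))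

combo-∷∷ : ∀ {v d} (c₁ c₂ : Bool) (cs : Vec Bool d) (x y : V v) (Xs : Vec (V v) d) →
  combo (c₁ ∷ c₂ ∷ cs) (x ∷ y ∷ Xs) ≡ ((c₁ · x) ⊕ (c₂ · y)) ⊕ combo cs Xs
combo-∷∷ c₁ c₂ cs x y Xs =
  trans (combo-∷ c₁ (c₂ ∷ cs) x (y ∷ Xs)) (trans (cong ((c₁ · x) ⊕_) (combo-∷ c₂ cs y Xs)) (sym (⊕-assoc _ _ _)))

independent-triple : ∀ {m} (x₁ x₂ x₃ : V m) → x₁ ≢ 0v → x₂ ≢ 0v → x₃ ≢ 0v → x₁ ≢ x₂ → x₁ ≢ x₃ → x₂ ≢ x₃ →
  x₁ ⊕ (x₂ ⊕ x₃) ≢ 0v → LinIndep (x₁ ∷ x₂ ∷ x₃ ∷ [])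
independent-triple x₁ x₂ x₃ n₁ n₂ n₃ n₁₂ n₁₃ n₂₃ n₁₂₃ (d₁ ∷ d₂ ∷ d₃ ∷ []) e =
  cases d₁ d₂ d₃ (trans (sym (trans (combo-∷∷ d₁ d₂ (d₃ ∷ []) x₁ x₂ (x₃ ∷ [])) (⊕-assoc _ _ _))) e)
  where
  cases : ∀ d₁ d₂ d₃ → (d₁ · x₁) ⊕ ((d₂ · x₂) ⊕ combo (d₃ ∷ []) (x₃ ∷ [])) ≡ 0v → d₁ ∷ d₂ ∷ d₃ ∷ [] ≡ 0v
  cases false false false e = refl
  cases true  false false e = ⊥-elim (n₁ (trans (sym (trans (cong (x₁ ⊕_) (⊕-identityˡ 0v)) (⊕-identityʳ x₁))) e))
  cases false true  false e = ⊥-elim (n₂ (trans (sym (trans (⊕-identityˡ _) (⊕-identityʳ x₂))) e))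
  cases false false true  e = ⊥-elim (n₃ (trans (sym (trans (⊕-identityˡ _) (trans (⊕-identityˡ _) (⊕-identityʳ x₃)))) e))
  cases true  true  false e = ⊥-elim (n₁₂ (⊕≡0⇒≡ x₁ x₂ (trans (cong (x₁ ⊕_) (sym (⊕-identityʳ x₂))) e)))
  cases true  false true  e = ⊥-elim (n₁₃ (⊕≡0⇒≡ x₁ x₃ (trans (cong (x₁ ⊕_) (sym (trans (⊕-identityˡ _) (⊕-identityʳ x₃)))) e)))
  cases false true  true  e = ⊥-elim (n₂₃ (⊕≡0⇒≡ x₂ x₃ (trans (sym (trans (⊕-identityˡ _) (cong (x₂ ⊕_) (⊕-identityʳ x₃)))) e)))
  cases true  true  true  e = ⊥-elim (n₁₂₃ (trans (cong (λ z → x₁ ⊕ (x₂ ⊕ z)) (sym (⊕-identityʳ x₃))) e))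

module Setting (q f : ℕ) where
  open Rotation q

  n : ℕ
  n = q * 2

  v : ℕ
  v = n + f

  cyc : V v → V n
  cyc = take n

  triv : V v → V f
  triv = drop n

  parts : ∀ y → y ≡ cyc y ++ triv y
  parts y = sym (VecP.take++drop≡id n y)

  from-parts : ∀ {y a c} → cyc y ≡ a → triv y ≡ c → y ≡ a ++ c
  from-parts {y} refl refl = parts y

  triv-combo : ∀ {d} (c : Vec Bool d) (B : Vec (V v) d) → triv (combo c B) ≡ combo c (V.map triv B)
  triv-combo = combo-map triv (VecP.drop-zipWith _xor_) (trans (cong triv (sym (0v-++ {n} {f}))) (drop-++ (0v {n}) (0v {f})))

  act-++ : ∀ k (a : V n) (c : V f) → act^ v f k (a ++ c) ≡ ρ^ k a ++ c
  act-++ zero    a c = refl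
  act-++ (suc k) a c = trans (cong (_·ᴹ A v f) (act-++ k a c)) (mul-A q f (ρ^ k a) c)

  act-parts : ∀ k (y : V v) → act^ v f k y ≡ ρ^ k (cyc y) ++ triv y
  act-parts k y = trans (cong (act^ v f k) (parts y)) (act-++ k (cyc y) (triv y))

  act-fixes : ∀ k (y : V v) → cyc y ≡ 0v → act^ v f k y ≡ y
  act-fixes k y e = trans (act-parts k y) (trans (cong (λ z → ρ^ k z ++ triv y) e)
    (trans (cong (_++ triv y) (ρ^-0 k)) (sym (from-parts e refl))))

  fixed⇒cyc≡0 : ∀ (y : V v) → act^ v f 1 y ≡ y → cyc y ≡ 0v
  fixed⇒cyc≡0 y e = rot-fixed q (cyc y) (VecP.++-injectiveˡ _ _ (trans (sym (act-parts 1 y)) (trans e (parts y))))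

  ++≢0ˡ : ∀ {a : V n} {c : V f} → a ≢ 0v → a ++ c ≢ 0v
  ++≢0ˡ a≢0 e = a≢0 (++≡0⇒ˡ e)

  ++≢0ʳ : ∀ {a : V n} {c : V f} → c ≢ 0v → a ++ c ≢ 0v
  ++≢0ʳ {a} c≢0 e = c≢0 (++≡0⇒ʳ {a = a} e)

  -- Type 7.  A type-7 plane consists of fixed vectors, so it is 0 ++ E for a
  -- plane E of F₂^f; E is described by its echelon basis.
  InFixedPart : Echelon 3 f → V v → Set
  InFixedPart (R , _) y = (cyc y ≡ 0v) × InSpan R (triv y)

  InFixedPart? : ∀ p → Decidable (InFixedPart p)
  InFixedPart? (R , _) y = (cyc y ≟ᵛ 0v) ×-dec InSpan? R (triv y)

  fixedBasis : Vec (V f) 3 → Vec (V v) 3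
  fixedBasis R = zipWith _++_ (replicate 3 0v) R

  combo-fixedBasis : ∀ c R → combo c (fixedBasis R) ≡ 0v ++ combo c R
  combo-fixedBasis c R = trans (combo-++ c (replicate 3 0v) R) (cong (_++ combo c R) (combo-zeroʳ c))

  type7-valid : ∀ {p} → p ∈ echelons 3 f → ∀ S → Unique S → S enumerates InFixedPart p → Type7 v f S
  type7-valid {R , m} p∈ S _ (inS⇒ , ⇒inS) = (isPlane , fixed) , (λ x x∈ _ k → act-fixes k x (proj₁ (inS⇒ x x∈)))
    where
    independent : LinIndep (fixedBasis R)
    independent c e = echelon-independent p∈ c (++≡0⇒ʳ {a = 0v {n}} (trans (sym (combo-fixedBasis c R)) e))
    isPlane : IsPlane v S
    isPlane = fixedBasis R , independent , λ y → mk⇔ (to y) (from y)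
      where
      to : ∀ y → y ∈ S → InSpan (fixedBasis R) y
      to y y∈ = let (cyc≡0 , c , e) = inS⇒ y y∈ in c , trans (combo-fixedBasis c R) (sym (from-parts cyc≡0 (sym e)))
      from : ∀ y → InSpan (fixedBasis R) y → y ∈ S
      from _ (c , refl) = ⇒inS _ (subst (InFixedPart (R , m)) (sym (combo-fixedBasis c R))
        (take-++ 0v (combo c R) , c , sym (drop-++ (0v {n}) (combo c R))))
    fixed : ∀ k y → (y ∈ S) ⇔ (∃[ x ] (x ∈ S × act^ v f k x ≡ y))
    fixed k y = mk⇔ (λ y∈ → y , y∈ , act-fixes k y (proj₁ (inS⇒ y y∈)))
                    (λ { (x , x∈ , refl) → subst (_∈ S) (sym (act-fixes k x (proj₁ (inS⇒ x x∈)))) x∈ })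

  type7-injective : ∀ {p p'} → p ∈ echelons 3 f → p' ∈ echelons 3 f →
    (∀ y → InFixedPart p y → InFixedPart p' y) → (∀ y → InFixedPart p' y → InFixedPart p y) → p ≡ p'
  type7-injective {R , m} {R' , m'} h h' i j = echelon-unique h h' (span⊑ {mx = m} {my = m'} i) (span⊑ {mx = m'} {my = m} j)
    where
    span⊑ : ∀ {X Y : Vec (V f) 3} {mx my} → (∀ y → InFixedPart (X , mx) y → InFixedPart (Y , my) y) → X ⊑ Y
    span⊑ {X} {Y} k w s = subst (InSpan Y) (drop-++ (0v {n}) w)
      (proj₂ (k (0v ++ w) (take-++ 0v w , subst (InSpan X) (sym (drop-++ (0v {n}) w)) s)))

  type7-complete : ∀ S → S ∈ Subsets v → Type7 v f S → ∃[ p ] (p ∈ echelons 3 f × S enumerates InFixedPart p)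
  type7-complete S _ (((B , ind , mem) , _) , allFixed) =
    p , p∈ , (λ y y∈ → cyc≡0 y y∈ , W⊑R _ (inW y y∈)) , from
    where
    inS : ∀ c → combo c B ∈ S
    inS c = Equivalence.from (mem _) (c , refl)
    cyc≡0 : ∀ x → x ∈ S → cyc x ≡ 0v
    cyc≡0 x x∈ with x ≟ᵛ 0v
    ... | yes refl = trans (cong cyc (sym (0v-++ {n} {f}))) (take-++ (0v {n}) (0v {f}))
    ... | no x≢0   = fixed⇒cyc≡0 x (allFixed x x∈ x≢0 1)
    W : Vec (V f) 3
    W = V.map triv B
    combo-B : ∀ c → combo c B ≡ 0v ++ combo c W
    combo-B c = from-parts (cyc≡0 _ (inS c)) (triv-combo c B)
    echelonOfW : ∃[ p ] (p ∈ echelons 3 f × proj₁ p ⊑ W × W ⊑ proj₁ p)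
    echelonOfW = echelon-exists f 3 W λ c e → ind c (trans (combo-B c) (trans (cong (0v ++_) e) (0v-++ {n} {f})))
    p : Echelon 3 f
    p = proj₁ echelonOfW
    p∈ : p ∈ echelons 3 f
    p∈ = proj₁ (proj₂ echelonOfW)
    R⊑W : proj₁ p ⊑ W
    R⊑W = proj₁ (proj₂ (proj₂ echelonOfW))
    W⊑R : W ⊑ proj₁ p
    W⊑R = proj₂ (proj₂ (proj₂ echelonOfW))
    inW : ∀ y → y ∈ S → InSpan W (triv y)
    inW y y∈ = let (c , e) = Equivalence.to (mem y) y∈ in c , trans (sym (triv-combo c B)) (cong triv e)
    from : ∀ y → InFixedPart p y → y ∈ S
    from y (cyc≡0' , s) = let (c , e) = R⊑W _ s in
      subst (_∈ S) (trans (combo-B c) (sym (from-parts cyc≡0' (sym e)))) (inS c)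

  count7 : NumberOf v (Type7 v f) (gauss 3 f)
  count7 = count-by-parameters (echelons 3 f) InFixedPart InFixedPart? (Type7 v f) (echelons-unique 3 f)
    type7-injective type7-valid type7-complete

  -- Type 1.  For a ≠ 0 in F₂^(2q) and p ≠ 0 in F₂^f, the plane
  -- E(a, p) = {t ++ c | t on the orbit line of a, c ∈ {0, p}} is fixed by A
  -- but not pointwise.
  InPlaneE : V n × V f → V v → Set
  InPlaneE (a , p) y = OnOrbitLine a (cyc y) × (triv y ≡ 0v ⊎ triv y ≡ p)

  InPlaneE? : ∀ ap → Decidable (InPlaneE ap)
  InPlaneE? (a , p) y = OnOrbitLine? a (cyc y) ×-dec ((triv y ≟ᵛ 0v) ⊎-dec (triv y ≟ᵛ p))

  InPlaneE-++ : ∀ {a p} t c → OnOrbitLine a t → (c ≡ 0v ⊎ c ≡ p) → InPlaneE (a , p) (t ++ c)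
  InPlaneE-++ {a} {p} t c o d =
    subst (OnOrbitLine a) (sym (take-++ t c)) o , subst (λ z → z ≡ 0v ⊎ z ≡ p) (sym (drop-++ t c)) d

  planeBasis : V n → V f → Vec (V v) 3
  planeBasis a p = zipWith _++_ (a ∷ ρ a ∷ 0v ∷ []) (0v ∷ 0v ∷ p ∷ [])

  combo-planeBasis : ∀ c₁ c₂ c₃ a p → combo (c₁ ∷ c₂ ∷ c₃ ∷ []) (planeBasis a p) ≡ lineCombo c₁ c₂ a ++ (c₃ · p)
  combo-planeBasis c₁ c₂ c₃ a p = trans (combo-++ (c₁ ∷ c₂ ∷ c₃ ∷ []) (a ∷ ρ a ∷ 0v ∷ []) (0v ∷ 0v ∷ p ∷ []))
    (cong₂ _++_ cyclic fixedPart)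
    where
    cyclic : combo (c₁ ∷ c₂ ∷ c₃ ∷ []) (a ∷ ρ a ∷ 0v ∷ []) ≡ lineCombo c₁ c₂ a
    cyclic = trans (combo-∷∷ c₁ c₂ (c₃ ∷ []) a (ρ a) (0v ∷ []))
      (trans (cong (lineCombo c₁ c₂ a ⊕_) (combo-zeroʳ (c₃ ∷ []))) (⊕-identityʳ _))
    fixedPart : combo (c₁ ∷ c₂ ∷ c₃ ∷ []) (0v ∷ 0v ∷ p ∷ []) ≡ c₃ · p
    fixedPart = trans (combo-∷∷ c₁ c₂ (c₃ ∷ []) 0v 0v (p ∷ []))
      (trans (cong₂ _⊕_ (trans (cong₂ _⊕_ (·-0v c₁) (·-0v c₂)) (⊕-identityˡ 0v)) (combo-∷ c₃ [] p []))
        (trans (⊕-identityˡ _) (⊕-identityʳ _)))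

  planeBasis-span⇒ : ∀ {a p y} → InSpan (planeBasis a p) y → InPlaneE (a , p) y
  planeBasis-span⇒ {a} {p} (c₁ ∷ c₂ ∷ c₃ ∷ [] , refl) rewrite combo-planeBasis c₁ c₂ c₃ a p =
    InPlaneE-++ _ _ (lineCombo-OnOrbitLine c₁ c₂ a) (scaled c₃)
    where
    scaled : ∀ c → c · p ≡ 0v ⊎ c · p ≡ p
    scaled true  = inj₂ refl
    scaled false = inj₁ refl

  planeBasis-span⇐ : ∀ {a p y} → InPlaneE (a , p) y → InSpan (planeBasis a p) y
  planeBasis-span⇐ {a} {p} {y} (o , d) with OnOrbitLine-lineCombo o
  ... | c₁ , c₂ , e = c₁ ∷ c₂ ∷ coefficient d ∷ [] ,
        trans (combo-planeBasis c₁ c₂ (coefficient d) a p) (sym (from-parts (sym e) (scaled d)))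
    where
    coefficient : triv y ≡ 0v ⊎ triv y ≡ p → Bool
    coefficient (inj₁ _) = false
    coefficient (inj₂ _) = true
    scaled : ∀ d → triv y ≡ coefficient d · p
    scaled (inj₁ e) = e
    scaled (inj₂ e) = e

  planeBasis-independent : ∀ {a p} → a ≢ 0v → p ≢ 0v → LinIndep (planeBasis a p)
  planeBasis-independent {a} {p} a≢0 p≢0 (c₁ ∷ c₂ ∷ c₃ ∷ []) e
    with VecP.++-injective (lineCombo c₁ c₂ a) 0v (trans (sym (combo-planeBasis c₁ c₂ c₃ a p)) (trans e (sym (0v-++ {n} {f}))))
  ... | e₁ , e₂ with lineCombo≡0 c₁ c₂ a≢0 e₁
  ... | refl , refl = cong (λ z → false ∷ false ∷ z ∷ []) (unscaled c₃ e₂)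
    where
    unscaled : ∀ c → c · p ≡ 0v → c ≡ false
    unscaled false _ = refl
    unscaled true  e = ⊥-elim (p≢0 e)

  orbitData : List (V n × V f)
  orbitData = pairsOver (orbitReps q) (λ _ → nonzeros f)

  orbitData-unique : Unique orbitData
  orbitData-unique = pairsOver-unique (orbitReps-unique q) (λ _ → nonzeros-unique f)

  orbitData-∈⁻ : ∀ {u p} → (u , p) ∈ orbitData → (u ∈ orbitReps q) × (p ∈ nonzeros f)
  orbitData-∈⁻ = pairsOver-∈⁻ (orbitReps q) (λ _ → nonzeros f)

  type1-valid : ∀ {up} → up ∈ orbitData → ∀ S → Unique S → S enumerates InPlaneE up → Type1 v f S
  type1-valid {u , p} h S _ (inS⇒ , ⇒inS) = (isPlane , fixed) , notAllFixed
    where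
    u≢0 : u ≢ 0v
    u≢0 = orbitReps-nonzero q (proj₁ (orbitData-∈⁻ h))
    p≢0 : p ≢ 0v
    p≢0 = nonzeros-∈⁻ (proj₂ (orbitData-∈⁻ h))
    isPlane : IsPlane v S
    isPlane = planeBasis u p , planeBasis-independent u≢0 p≢0 ,
              λ y → mk⇔ (λ y∈ → planeBasis-span⇐ (inS⇒ y y∈)) (λ s → ⇒inS y (planeBasis-span⇒ s))
    -- y = x A^k with x = ρ^(2k) (cyc y) ++ triv y
    fixed : ∀ k y → (y ∈ S) ⇔ (∃[ x ] (x ∈ S × act^ v f k x ≡ y))
    fixed k y = mk⇔ to from
      where
      to : y ∈ S → ∃[ x ] (x ∈ S × act^ v f k x ≡ y)
      to y∈ = let (o , d) = inS⇒ y y∈ in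
        ρ^ (k * 2) (cyc y) ++ triv y , ⇒inS _ (InPlaneE-++ _ _ (OnOrbitLine-ρ^ (k * 2) o) d) ,
        trans (act-++ k _ (triv y)) (trans (cong (_++ triv y) (ρ^-inverse k (cyc y))) (sym (parts y)))
      from : ∃[ x ] (x ∈ S × act^ v f k x ≡ y) → y ∈ S
      from (x , x∈ , refl) = let (o , d) = inS⇒ x x∈ in
        ⇒inS _ (subst (InPlaneE (u , p)) (sym (act-parts k x)) (InPlaneE-++ _ _ (OnOrbitLine-ρ^ k o) d))
    notAllFixed : ¬ (∀ x → x ∈ S → x ≢ 0v → ∀ k → act^ v f k x ≡ x)
    notAllFixed allFixed = ρ-moves u≢0 (VecP.++-injectiveˡ _ _ (trans (sym (act-++ 1 u 0v))
      (allFixed (u ++ 0v) (⇒inS _ (InPlaneE-++ u 0v (inj₂ (inj₁ refl)) (inj₁ refl))) (++≢0ˡ u≢0) 1)))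

  type1-injective : ∀ {up up'} → up ∈ orbitData → up' ∈ orbitData →
    (∀ y → InPlaneE up y → InPlaneE up' y) → (∀ y → InPlaneE up' y → InPlaneE up y) → up ≡ up'
  type1-injective {u , p} {u' , p'} h h' i _ = cong₂ _,_ u≡u' p≡p'
    where
    uInE : InPlaneE (u' , p') (u ++ 0v)
    uInE = i (u ++ 0v) (InPlaneE-++ u 0v (inj₂ (inj₁ refl)) (inj₁ refl))
    pInE : InPlaneE (u' , p') (0v ++ p)
    pInE = i (0v ++ p) (InPlaneE-++ 0v p (inj₁ refl) (inj₂ refl))
    u≡u' : u ≡ u'
    u≡u' with subst (OnOrbitLine u') (take-++ u 0v) (proj₁ uInE)
    ... | inj₁ u≡0 = ⊥-elim (orbitReps-nonzero q (proj₁ (orbitData-∈⁻ h)) u≡0)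
    ... | inj₂ o   = orbitReps-distinct q (proj₁ (orbitData-∈⁻ h')) (proj₁ (orbitData-∈⁻ h)) o
    p≡p' : p ≡ p'
    p≡p' with subst (λ z → z ≡ 0v ⊎ z ≡ p') (drop-++ (0v {n}) p) (proj₂ pInE)
    ... | inj₁ p≡0 = ⊥-elim (nonzeros-∈⁻ (proj₂ (orbitData-∈⁻ h)) p≡0)
    ... | inj₂ e   = e

  lineBasis : V n → Vec (V v) 2
  lineBasis a = zipWith _++_ (a ∷ ρ a ∷ []) (0v ∷ 0v ∷ [])

  combo-lineBasis : ∀ c₁ c₂ a → combo (c₁ ∷ c₂ ∷ []) (lineBasis a) ≡ lineCombo c₁ c₂ a ++ 0v
  combo-lineBasis c₁ c₂ a = trans (combo-++ (c₁ ∷ c₂ ∷ []) (a ∷ ρ a ∷ []) (0v ∷ 0v {f} ∷ []))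
    (cong₂ _++_ (trans (combo-∷∷ c₁ c₂ [] a (ρ a) []) (⊕-identityʳ _)) (combo-zeroʳ (c₁ ∷ c₂ ∷ [])))

  twoLines : V n → V n → Vec (V v) 4
  twoLines a a' = zipWith _++_ (a ∷ ρ a ∷ a' ∷ ρ a' ∷ []) (replicate 4 0v)

  -- orbit lines through distinct orbits meet only in 0
  twoLines-independent : ∀ {a a'} → a ≢ 0v → ¬ OnOrbitLine a a' → LinIndep (twoLines a a')
  twoLines-independent {a} {a'} a≢0 off (c₁ ∷ c₂ ∷ c₃ ∷ c₄ ∷ []) e = coefficients c₃ c₄ sameLineCombo
    where
    cs : Vec Bool 4
    cs = c₁ ∷ c₂ ∷ c₃ ∷ c₄ ∷ []
    combo≡0 : combo cs (a ∷ ρ a ∷ a' ∷ ρ a' ∷ []) ≡ 0v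
    us : Vec (V n) 4
    us = a ∷ ρ a ∷ a' ∷ ρ a' ∷ []
    combo≡0 = ++≡0⇒ˡ {c = 0v {f}} (trans (sym (trans (combo-++ cs us (replicate 4 0v)) (cong (combo cs us ++_) (combo-zeroʳ cs)))) e)
    sameLineCombo : lineCombo c₁ c₂ a ≡ lineCombo c₃ c₄ a'
    sameLineCombo = ⊕≡0⇒≡ _ _ (trans (cong (lineCombo c₁ c₂ a ⊕_)
      (sym (trans (combo-∷∷ c₃ c₄ [] a' (ρ a') []) (⊕-identityʳ _)))) (trans (sym (combo-∷∷ c₁ c₂ (c₃ ∷ c₄ ∷ []) a (ρ a) (a' ∷ ρ a' ∷ []))) combo≡0))
    onLine : ∀ c₃ c₄ → ¬ ((c₃ ≡ false) × (c₄ ≡ false)) → lineCombo c₁ c₂ a ≡ lineCombo c₃ c₄ a' → ⊥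
    onLine c₃ c₄ nz eq = off (OnOrbitLine-InOrbit (subst (OnOrbitLine a) eq (lineCombo-OnOrbitLine c₁ c₂ a))
                                                  (InOrbit-sym (lineCombo-InOrbit c₃ c₄ nz)))
    coefficients : ∀ c₃ c₄ → lineCombo c₁ c₂ a ≡ lineCombo c₃ c₄ a' → c₁ ∷ c₂ ∷ c₃ ∷ c₄ ∷ [] ≡ 0v
    coefficients false false eq with lineCombo≡0 c₁ c₂ a≢0 (trans eq (⊕-identityˡ 0v))
    ... | refl , refl = refl
    coefficients true  c₄   eq = ⊥-elim (onLine true c₄ (λ ()) eq)
    coefficients false true eq = ⊥-elim (onLine false true (λ ()) eq)

  module FixedPlane (S : List (V v)) (B : Vec (V v) 3) (ind : LinIndep B)
      (mem : ∀ y → (y ∈ S) ⇔ (∃[ c ] combo c B ≡ y))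
      (fx : ∀ k y → (y ∈ S) ⇔ (∃[ x ] (x ∈ S × act^ v f k x ≡ y))) where

    toS : ∀ {y} → InSpan B y → y ∈ S
    toS {y} = Equivalence.from (mem y)

    fromS : ∀ {y} → y ∈ S → InSpan B y
    fromS {y} = Equivalence.to (mem y)

    S-0 : 0v ∈ S
    S-0 = toS (span-0 B)

    S-⊕ : ∀ {x y} → x ∈ S → y ∈ S → (x ⊕ y) ∈ S
    S-⊕ a b = toS (span-⊕ B (fromS a) (fromS b))

    S-A : ∀ {x} → x ∈ S → act^ v f 1 x ∈ S
    S-A {x} x∈ = Equivalence.from (fx 1 _) (x , x∈ , refl)

    S-ρ : ∀ {a c} → (a ++ c) ∈ S → (ρ a ++ c) ∈ S
    S-ρ {a} {c} h = subst (_∈ S) (act-++ 1 a c) (S-A h)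

    -- the cyclic part of z ∈ S lies in S: z + zA = ρ²(cyc z) ++ 0, then apply A
    cyc-part∈ : ∀ {z} → z ∈ S → (cyc z ++ 0v) ∈ S
    cyc-part∈ {z} z∈ = subst (_∈ S) (cong (_++ 0v) (rot³ q (cyc z))) (S-ρ (subst (_∈ S) sum (S-⊕ z∈ (S-A z∈))))
      where
      sum : z ⊕ act^ v f 1 z ≡ ρ² (cyc z) ++ 0v
      sum = trans (cong₂ _⊕_ (parts z) (act-parts 1 z))
        (trans (⊕-++ (cyc z) _ (triv z) _) (cong₂ _++_ (rot-sum q (cyc z)) (⊕-self (triv z))))

    triv-part∈ : ∀ {z} → z ∈ S → (0v ++ triv z) ∈ S
    triv-part∈ {z} z∈ = subst (_∈ S) sum (S-⊕ (cyc-part∈ z∈) z∈)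
      where
      sum : (cyc z ++ 0v) ⊕ z ≡ 0v ++ triv z
      sum = trans (cong ((cyc z ++ 0v) ⊕_) (parts z))
        (trans (⊕-++ (cyc z) _ 0v _) (cong₂ _++_ (⊕-self (cyc z)) (⊕-identityˡ (triv z))))

    parts∈ : ∀ {y} → (cyc y ++ 0v) ∈ S → (0v ++ triv y) ∈ S → y ∈ S
    parts∈ {y} a b = subst (_∈ S) sum (S-⊕ a b)
      where
      sum : (cyc y ++ 0v) ⊕ (0v ++ triv y) ≡ y
      sum = trans (⊕-++ (cyc y) 0v 0v (triv y))
        (trans (cong₂ _++_ (⊕-identityʳ (cyc y)) (⊕-identityˡ (triv y))) (sym (parts y)))

    orbitLine⊆S : ∀ {a t} → (a ++ 0v) ∈ S → OnOrbitLine a t → (t ++ 0v) ∈ S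
    orbitLine⊆S h (inj₁ refl)               = subst (_∈ S) (sym (0v-++ {n} {f})) S-0
    orbitLine⊆S h (inj₂ (inj₁ refl))        = h
    orbitLine⊆S h (inj₂ (inj₂ (inj₁ refl))) = S-ρ h
    orbitLine⊆S h (inj₂ (inj₂ (inj₂ refl))) = S-ρ (S-ρ h)

    -- a fixed plane through a ++ 0 and 0 ++ p is E(a, p): it contains E(a, p)
    -- and a fourth independent vector would exceed its dimension
    plane-is-E : ∀ {a p} → a ≢ 0v → (a ++ 0v) ∈ S → p ≢ 0v → (0v ++ p) ∈ S → S enumerates InPlaneE (a , p)
    plane-is-E {a} {p} a≢0 a∈ p≢0 p∈ = to , from
      where
      from : ∀ y → InPlaneE (a , p) y → y ∈ S
      from y (o , inj₁ e) = parts∈ (orbitLine⊆S a∈ o) (subst (λ c → (0v ++ c) ∈ S) (sym e) (subst (_∈ S) (sym (0v-++ {n} {f})) S-0))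
      from y (o , inj₂ e) = parts∈ (orbitLine⊆S a∈ o) (subst (λ c → (0v ++ c) ∈ S) (sym e) p∈)
      to : ∀ y → y ∈ S → InPlaneE (a , p) y
      to y y∈ with InPlaneE? (a , p) y
      ... | yes inE = inE
      ... | no ¬inE = ⊥-elim (span-dimension-bound B (y ∷ planeBasis a p) (NP.n<1+n 3) gens
                        (extend-independent (planeBasis-independent a≢0 p≢0) (λ s → ¬inE (planeBasis-span⇒ s))))
        where
        gens : ∀ i → InSpan B (lookup (y ∷ planeBasis a p) i)
        gens F.zero                         = fromS y∈
        gens (F.suc F.zero)                 = fromS a∈
        gens (F.suc (F.suc F.zero))         = fromS (S-ρ a∈)
        gens (F.suc (F.suc (F.suc F.zero))) = fromS p∈

    -- a fixed plane through a ++ 0 (a ≠ 0) is not contained in F₂^(2q) ++ 0: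
    -- otherwise it would lie on the orbit line of a, or contain two orbit lines
    has-fixed-part : ∀ {a} → a ≢ 0v → (a ++ 0v) ∈ S → ∃[ z ] (z ∈ S × triv z ≢ 0v)
    has-fixed-part {a} a≢0 a∈ with find-or-all (λ z → triv z ≟ᵛ 0v) S
    ... | inj₁ found = found
    ... | inj₂ allTriv0 with find-or-all (λ z → OnOrbitLine? a (cyc z)) S
    ...   | inj₂ allOnLine = ⊥-elim (span-dimension-bound (lineBasis a) B (NP.n<1+n 2) onLine ind)
      where
      genS : ∀ i → lookup B i ∈ S
      genS i = toS (span-gen B i)
      onLine : ∀ i → InSpan (lineBasis a) (lookup B i)
      onLine i with OnOrbitLine-lineCombo (allOnLine _ (genS i))
      ... | c₁ , c₂ , e = c₁ ∷ c₂ ∷ [] , trans (combo-lineBasis c₁ c₂ a) (sym (from-parts (sym e) (allTriv0 _ (genS i))))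
    ...   | inj₁ (z , z∈ , off) = ⊥-elim (span-dimension-bound B (twoLines a (cyc z)) (NP.n<1+n 3) gens
                                    (twoLines-independent a≢0 off))
      where
      gens : ∀ i → InSpan B (lookup (twoLines a (cyc z)) i)
      gens F.zero                         = fromS a∈
      gens (F.suc F.zero)                 = fromS (S-ρ a∈)
      gens (F.suc (F.suc F.zero))         = fromS (cyc-part∈ z∈)
      gens (F.suc (F.suc (F.suc F.zero))) = fromS (S-ρ (cyc-part∈ z∈))

    -- a fixed plane containing a vector x with cyc x ≠ 0 is E(u, p) for
    -- u the representative of the orbit of cyc x
    classify : ∀ {x} → x ∈ S → cyc x ≢ 0v → ∃[ up ] (up ∈ orbitData × S enumerates InPlaneE up)
    classify {x} x∈ a≢0 with has-fixed-part a≢0 (cyc-part∈ x∈) | orbitReps-complete q (cyc x) a≢0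
    ... | z , z∈ , p≢0 | u , u∈ , a~u =
      (u , triv z) , pairsOver-∈⁺ u∈ (nonzeros-∈⁺ (triv z) p≢0) ,
      (λ y y∈ → let (o , d) = proj₁ E y y∈ in OnOrbitLine-change a~u o , d) ,
      (λ y (o , d) → proj₂ E y (OnOrbitLine-change (InOrbit-sym a~u) o , d))
      where
      E : S enumerates InPlaneE (cyc x , triv z)
      E = plane-is-E a≢0 (cyc-part∈ x∈) p≢0 (triv-part∈ z∈)

  type1-complete : ∀ S → S ∈ Subsets v → Type1 v f S → ∃[ up ] (up ∈ orbitData × S enumerates InPlaneE up)
  type1-complete S _ (((B , ind , mem) , fx) , notAllFixed) with find-or-all (λ x → cyc x ≟ᵛ 0v) S
  ... | inj₁ (x , x∈ , moving) = FixedPlane.classify S B ind mem fx x∈ moving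
  ... | inj₂ allCyc0          = ⊥-elim (notAllFixed (λ x x∈ _ k → act-fixes k x (allCyc0 x x∈)))

  count1 : NumberOf v (Type1 v f) (length orbitData)
  count1 = count-by-parameters orbitData InPlaneE InPlaneE? (Type1 v f) orbitData-unique
    type1-injective type1-valid type1-complete

  -- Orbit triangles.  The orbit of u ++ w (u ≠ 0) is {ρ^k u ++ w}; it is a
  -- triangle exactly when w ≠ 0 (for w = 0 it lies on the orbit line of u).
  InTriangle : V n × V f → V v → Set
  InTriangle (u , w) y = InOrbit u (cyc y) × (triv y ≡ w)

  InTriangle? : ∀ uw → Decidable (InTriangle uw)
  InTriangle? (u , w) y = InOrbit? u (cyc y) ×-dec (triv y ≟ᵛ w)

  InTriangle-++ : ∀ {u w} (a : V n) → InOrbit u a → InTriangle (u , w) (a ++ w)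
  InTriangle-++ {u} {w} a o = subst (InOrbit u) (sym (take-++ a w)) o , drop-++ a w

  orbitPoints : V n → V f → Vec (V v) 3
  orbitPoints u w = (u ++ w) ∷ (ρ u ++ w) ∷ (ρ² u ++ w) ∷ []

  orbitPoints-distinct : ∀ {u} (w : V f) → u ≢ 0v →
    (u ++ w ≢ ρ u ++ w) × (u ++ w ≢ ρ² u ++ w) × (ρ u ++ w ≢ ρ² u ++ w)
  orbitPoints-distinct {u} w u≢0 =
    (λ e → ρ-moves u≢0 (sym (VecP.++-injectiveˡ u (ρ u) e))) ,
    (λ e → ρ²-moves u≢0 (sym (VecP.++-injectiveˡ u (ρ² u) e))) ,
    (λ e → ρ²≢ρ u≢0 (sym (VecP.++-injectiveˡ (ρ u) (ρ² u) e)))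

  -- for w ≠ 0 the three points are independent: their sum is 0 ++ w ≠ 0
  orbitPoints-independent : ∀ {u w} → u ≢ 0v → w ≢ 0v → LinIndep (orbitPoints u w)
  orbitPoints-independent {u} {w} u≢0 w≢0 with orbitPoints-distinct w u≢0
  ... | n₁₂ , n₁₃ , n₂₃ =
    independent-triple _ _ _ (++≢0ʳ w≢0) (++≢0ʳ w≢0) (++≢0ʳ w≢0) n₁₂ n₁₃ n₂₃ (λ e → ++≢0ʳ w≢0 (trans (sym sum) e))
    where
    sum : (u ++ w) ⊕ ((ρ u ++ w) ⊕ (ρ² u ++ w)) ≡ 0v ++ w
    sum = trans (cong ((u ++ w) ⊕_) (⊕-++ (ρ u) (ρ² u) w w)) (trans (⊕-++ u _ w _)
      (cong₂ _++_ (trans (sym (⊕-assoc u _ _)) (trans (cong (_⊕ ρ² u) (rot-sum q u)) (⊕-self _)))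
                  (trans (cong (w ⊕_) (⊕-self w)) (⊕-identityʳ w))))

  triangle-valid : ∀ {uw} → uw ∈ orbitData → ∀ S → Unique S → S enumerates InTriangle uw → OrbitTriangle v f S
  triangle-valid {u , w} h S uniqueS (inS⇒ , ⇒inS) = isOrbit , length≡3 , notCollinear
    where
    u≢0 : u ≢ 0v
    u≢0 = orbitReps-nonzero q (proj₁ (orbitData-∈⁻ h))
    w≢0 : w ≢ 0v
    w≢0 = nonzeros-∈⁻ (proj₂ (orbitData-∈⁻ h))
    isOrbit : IsPointOrbit v f S
    isOrbit = u ++ w , ++≢0ʳ w≢0 , λ y → mk⇔ (to y) (from y)
      where
      to : ∀ y → y ∈ S → ∃[ k ] act^ v f k (u ++ w) ≡ y
      to y y∈ = let (o , d) = inS⇒ y y∈ ; (k , e) = InOrbit-ρ^ o in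
        k , trans (act-++ k u w) (sym (from-parts (sym e) d))
      from : ∀ y → ∃[ k ] act^ v f k (u ++ w) ≡ y → y ∈ S
      from y (k , refl) = ⇒inS _ (subst (InTriangle (u , w)) (sym (act-++ k u w)) (InTriangle-++ _ (ρ^-InOrbit k u)))
    points∈ : ∀ i → lookup (orbitPoints u w) i ∈ S
    points∈ F.zero                 = ⇒inS _ (InTriangle-++ u (inj₁ refl))
    points∈ (F.suc F.zero)         = ⇒inS _ (InTriangle-++ (ρ u) (inj₂ (inj₁ refl)))
    points∈ (F.suc (F.suc F.zero)) = ⇒inS _ (InTriangle-++ (ρ² u) (inj₂ (inj₂ refl)))
    length≡3 : length S ≡ 3
    length≡3 with orbitPoints-distinct w u≢0
    ... | n₁₂ , n₁₃ , n₂₃ = unique-same-length uniqueS ((n₁₂ ∷ n₁₃ ∷ []) ∷ (n₂₃ ∷ []) ∷ [] ∷ [])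
      (mk⇔ (λ z∈ → listed _ (inS⇒ _ z∈)) λ { (here refl) → points∈ F.zero ; (there (here refl)) → points∈ (F.suc F.zero)
                                           ; (there (there (here refl))) → points∈ (F.suc (F.suc F.zero)) })
      where
      listed : ∀ z → InTriangle (u , w) z → z ∈ V.toList (orbitPoints u w)
      listed z (inj₁ e , d)        = here (from-parts e d)
      listed z (inj₂ (inj₁ e) , d) = there (here (from-parts e d))
      listed z (inj₂ (inj₂ e) , d) = there (there (here (from-parts e d)))
    notCollinear : ¬ Collinear v S
    notCollinear (L , (Bl , _ , memL) , S⊆L) = span-dimension-bound Bl (orbitPoints u w) (NP.n<1+n 2)
      (λ i → Equivalence.to (memL _) (S⊆L _ (points∈ i))) (orbitPoints-independent u≢0 w≢0)

  triangle-injective : ∀ {uw uw'} → uw ∈ orbitData → uw' ∈ orbitData →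
    (∀ y → InTriangle uw y → InTriangle uw' y) → (∀ y → InTriangle uw' y → InTriangle uw y) → uw ≡ uw'
  triangle-injective {u , w} {u' , w'} h h' i _ with i (u ++ w) (InTriangle-++ u (inj₁ refl))
  ... | o , d = cong₂ _,_
    (orbitReps-distinct q (proj₁ (orbitData-∈⁻ h')) (proj₁ (orbitData-∈⁻ h)) (subst (InOrbit u') (take-++ u w) o))
    (trans (sym (drop-++ u w)) d)

  OnLineOf : V n → V v → Set
  OnLineOf a y = OnOrbitLine a (cyc y) × (triv y ≡ 0v)

  OnLineOf? : ∀ a → Decidable (OnLineOf a)
  OnLineOf? a y = OnOrbitLine? a (cyc y) ×-dec (triv y ≟ᵛ 0v)

  orbitLine-isLine : ∀ {a} → a ≢ 0v → IsLine v (subsetOf (OnLineOf? a))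
  orbitLine-isLine {a} a≢0 = lineBasis a , independent , λ y → mk⇔ (to y) (from y)
    where
    independent : LinIndep (lineBasis a)
    independent (c₁ ∷ c₂ ∷ []) e with lineCombo≡0 c₁ c₂ a≢0 (++≡0⇒ˡ (trans (sym (combo-lineBasis c₁ c₂ a)) e))
    ... | refl , refl = refl
    to : ∀ y → y ∈ subsetOf (OnLineOf? a) → InSpan (lineBasis a) y
    to y y∈ with proj₁ (subsetOf-enumerates (OnLineOf? a)) y y∈
    ... | o , d with OnOrbitLine-lineCombo o
    ... | c₁ , c₂ , e = c₁ ∷ c₂ ∷ [] , trans (combo-lineBasis c₁ c₂ a) (sym (from-parts (sym e) d))
    from : ∀ y → InSpan (lineBasis a) y → y ∈ subsetOf (OnLineOf? a)
    from _ (c₁ ∷ c₂ ∷ [] , refl) = proj₂ (subsetOf-enumerates (OnLineOf? a)) _ (subst (OnLineOf a) (sym (combo-lineBasis c₁ c₂ a))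
      (subst (OnOrbitLine a) (sym (take-++ (lineCombo c₁ c₂ a) 0v)) (lineCombo-OnOrbitLine c₁ c₂ a) ,
       drop-++ (lineCombo c₁ c₂ a) 0v))

  -- the orbit of x = a ++ c, with a ≠ 0 since the orbit has three points, and
  -- c ≠ 0 since otherwise the orbit lies on the orbit line of a
  triangle-complete : ∀ S → S ∈ Subsets v → OrbitTriangle v f S → ∃[ uw ] (uw ∈ orbitData × S enumerates InTriangle uw)
  triangle-complete S S∈ ((x , _ , memx) , length≡3 , notCollinear) =
    (u , c) , pairsOver-∈⁺ u∈ (nonzeros-∈⁺ c c≢0) , to , from
    where
    a : V n
    a = cyc x
    c : V f
    c = triv x
    orbitOf : ∀ y → y ∈ S → ∃[ k ] y ≡ ρ^ k a ++ c
    orbitOf y y∈ = let (k , e) = Equivalence.to (memx y) y∈ in k , trans (sym e) (act-parts k x)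
    x∈ : x ∈ S
    x∈ = Equivalence.from (memx x) (0 , refl)
    a≢0 : a ≢ 0v
    a≢0 a≡0 = case trans (sym length≡3) (unique-same-length (sublist-unique (allVecs-unique v) S∈) ([] ∷ [])
                (mk⇔ (λ y∈ → here (only _ y∈)) λ { (here refl) → x∈ })) of λ ()
      where
      only : ∀ y → y ∈ S → y ≡ x
      only y y∈ = let (k , e) = orbitOf y y∈ in
        trans e (trans (cong (λ z → ρ^ k z ++ c) a≡0) (trans (cong (_++ c) (ρ^-0 k)) (sym (from-parts a≡0 refl))))
    c≢0 : c ≢ 0v
    c≢0 c≡0 = notCollinear (subsetOf (OnLineOf? a) , orbitLine-isLine a≢0 , λ y y∈ → onLine y y∈)
      where
      onLine : ∀ y → y ∈ S → y ∈ subsetOf (OnLineOf? a)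
      onLine y y∈ with orbitOf y y∈
      ... | k , refl = proj₂ (subsetOf-enumerates (OnLineOf? a)) _
        (subst (OnOrbitLine a) (sym (take-++ (ρ^ k a) c)) (inj₂ (ρ^-InOrbit k a)) , trans (drop-++ (ρ^ k a) c) c≡0)
    representative : ∃[ u ] (u ∈ orbitReps q × InOrbit a u)
    representative = orbitReps-complete q a a≢0
    u : V n
    u = proj₁ representative
    u∈ : u ∈ orbitReps q
    u∈ = proj₁ (proj₂ representative)
    a~u : InOrbit a u
    a~u = proj₂ (proj₂ representative)
    to : ∀ y → y ∈ S → InTriangle (u , c) y
    to y y∈ with orbitOf y y∈
    ... | k , refl = InTriangle-++ (ρ^ k a) (InOrbit-trans (InOrbit-sym a~u) (ρ^-InOrbit k a))
    from : ∀ y → InTriangle (u , c) y → y ∈ S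
    from y (o , d) with InOrbit-ρ^ (InOrbit-trans a~u o)
    ... | k , e = Equivalence.from (memx y) (k , trans (act-parts k x) (sym (from-parts (sym e) d)))

  countTriangles : NumberOf v (OrbitTriangle v f) (length orbitData)
  countTriangles = count-by-parameters orbitData InTriangle InTriangle? (OrbitTriangle v f) orbitData-unique
    triangle-injective triangle-valid triangle-complete

  orbitData-length : length orbitData * 3 ≡ (2 ^ f ∸ 1) * (2 ^ n ∸ 1)
  orbitData-length = begin
      length orbitData * 3
        ≡⟨ cong (_* 3) (pairsOver-length (orbitReps q) (λ _ → nonzeros f) (mersenne f) (λ _ _ → nonzeros-length f)) ⟩
      length (orbitReps q) * mersenne f * 3
        ≡⟨ rearrange (length (orbitReps q)) (mersenne f) ⟩
      mersenne f * (length (orbitReps q) * 3)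
        ≡⟨ cong₂ _*_ (sym (mersenne≡2^∸1 f)) (trans (orbitReps-length q) (sym (mersenne≡2^∸1 n))) ⟩
      (2 ^ f ∸ 1) * (2 ^ n ∸ 1) ∎
    where
    open ≡-Reasoning
    rearrange : ∀ r m → r * m * 3 ≡ m * (r * 3)
    rearrange = solve-∀

lemma3 : (v f : ℕ) → 1 ≤ v → f < v → 2 ∣ (v ∸ f) →
    (∃[ n7 ] (NumberOf v (Type7 v f) n7
    × n7 * 21 ≡ (2 ^ f ∸ 1) * (2 ^ (f ∸ 1) ∸ 1) * (2 ^ (f ∸ 2) ∸ 1)))
    × (∃[ n1 ] (NumberOf v (Type1 v f) n1 × NumberOf v (OrbitTriangle v f) n1
    × n1 * 3 ≡ (2 ^ f ∸ 1) * (2 ^ (v ∸ f) ∸ 1)))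
lemma3 v f _ f<v (divides k v∸f≡k*2) = subst Claim v≡k*2+f claim
  where
  Claim : ℕ → Set
  Claim v = (∃[ n7 ] (NumberOf v (Type7 v f) n7
      × n7 * 21 ≡ (2 ^ f ∸ 1) * (2 ^ (f ∸ 1) ∸ 1) * (2 ^ (f ∸ 2) ∸ 1)))
    × (∃[ n1 ] (NumberOf v (Type1 v f) n1 × NumberOf v (OrbitTriangle v f) n1
      × n1 * 3 ≡ (2 ^ f ∸ 1) * (2 ^ (v ∸ f) ∸ 1)))
  open Setting k f using (count7; count1; countTriangles; orbitData; orbitData-length)
  v≡k*2+f : k * 2 + f ≡ v
  v≡k*2+f = trans (cong (_+ f) (sym v∸f≡k*2)) (NP.m∸n+n≡m (NP.<⇒≤ f<v))
  claim : Claim (k * 2 + f)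
  claim = (gauss 3 f , count7 , gauss-3-closed f) ,
          (length orbitData , count1 , countTriangles ,
           trans orbitData-length (cong (λ m → (2 ^ f ∸ 1) * (2 ^ m ∸ 1)) (sym (NP.m+n∸n≡m (k * 2) f))))
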